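{- Let $m_1,m_2\geq 3$ and $n_1=m_1+m_2-1$. Let $w_1$ be the cut vertex of $L_{n_1,n_1-1}$, let $w_2$ be the cut vertex of $C^{n_1}_{m_1,m_2}$, and let $H$ be a connected graph containing a vertex $w$. Let $G_1$ be obtained from $H$ and $L_{n_1,n_1-1}$ by identifying $w$ with $w_1$, $G_2$ be obtained from $H$ and $C^{n_1}_{m_1,m_2}$ by identifying $w$ with $w_2$, and $G$ be obtained from $H$ and the cycle $C_{n_1}$ by identifying $w$ with a vertex of $C_{n_1}$. Then for every $v\in V(H)$, $f_G(v)<f_{G_1}(v)$ and $f_G(v)<f_{G_2}(v)$.
   Context: $f_G(v)$ is the number of connected subgraphs of $G$ containing $v$ (connected subgraphs: nonempty subgraphs, i.e. vertex subsets with subsets of edges among them, that are connected; distinct subgraphs counted separately). $L_{n_1,n_1-1}$ is the cycle $C_{n_1-1}$ with one extra pendant vertex attached to a vertex of the cycle. $C^{n_1}_{m_1,m_2}$ (for $n_1=m_1+m_2-1$) is the graph obtained by identifying a vertex of the cycle $C_{m_1}$ with a vertex of the cycle $C_{m_2}$. -}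

module Defs where

open import Data.Nat using (ℕ; zero; suc; _+_; _∸_; _<_; _≤_; pred; s≤s; z≤n)
open import Data.Nat.Properties using (≤-trans; m≤m+n)
open import Data.Bool using (Bool; true; false; _∧_; _∨_; not; _xor_; if_then_else_)
open import Data.Fin using (Fin; zero; suc; _↑ˡ_; _↑ʳ_; inject₁; punchOut; fromℕ; fromℕ<; _≟_)
open import Data.List using (List; []; _∷_; [_]; _++_; map; concatMap; length; filterᵇ; allFin)
open import Data.Bool.ListAction using (all; any)
open import Data.List.Relation.Unary.All using (All)
open import Data.List.Relation.Unary.AllPairs using (AllPairs)
open import Data.Vec using (Vec; lookup; replicate)
import Data.Vec as V
open import Data.Product using (_×_; _,_; proj₁; proj₂; swap)
open import Data.Sum using (_⊎_)
open import Relation.Binary.PropositionalEquality using (_≡_; _≢_)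
open import Relation.Nullary using (¬_; yes; no)

-- Finite graphs: vertex set Fin order, edges given as a list of
-- (unordered) pairs of vertices.

record Graph : Set where
  constructor graph
  field
    order : ℕ
    edges : List (Fin order × Fin order)
open Graph public

SameEdge : ∀ {n} → (Fin n × Fin n) → (Fin n × Fin n) → Set
SameEdge e e' = (e ≡ e') ⊎ (swap e ≡ e')

Simple : Graph → Set
Simple G = All (λ e → proj₁ e ≢ proj₂ e) (edges G)
         × AllPairs (λ e e' → ¬ SameEdge e e') (edges G)

allSubsets : (n : ℕ) → List (Vec Bool n)
allSubsets zero    = [ V.[] ]
allSubsets (suc n) = concatMap (λ s → (true V.∷ s) ∷ (false V.∷ s) ∷ []) (allSubsets n)

-- all sub-collections of a list of edges (one entry per choice of positions)
sublists : ∀ {A : Set} → List A → List (List A)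
sublists []       = [ [] ]
sublists (x ∷ xs) = concatMap (λ ys → (x ∷ ys) ∷ ys ∷ []) (sublists xs)

module _ {n : ℕ} where

  nonemptyᵇ : Vec Bool n → Bool
  nonemptyᵇ S = any (lookup S) (allFin n)

  subsetᵇ : Vec Bool n → Vec Bool n → Bool
  subsetᵇ T S = all (λ x → not (lookup T x) ∨ lookup S x) (allFin n)

  -- T ≠ S, assuming T ⊆ S
  properᵇ : Vec Bool n → Vec Bool n → Bool
  properᵇ T S = any (λ x → lookup S x ∧ not (lookup T x)) (allFin n)

  edgesInᵇ : Vec Bool n → List (Fin n × Fin n) → Bool
  edgesInᵇ S es = all (λ e → lookup S (proj₁ e) ∧ lookup S (proj₂ e)) es

  crossesᵇ : Vec Bool n → List (Fin n × Fin n) → Bool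
  crossesᵇ T es = any (λ e → lookup T (proj₁ e) xor lookup T (proj₂ e)) es

  connectedᵇ : Vec Bool n → List (Fin n × Fin n) → Bool
  connectedᵇ S es =
    nonemptyᵇ S ∧
    all (λ T → not (subsetᵇ T S ∧ nonemptyᵇ T ∧ properᵇ T S) ∨ crossesᵇ T es)
        (allSubsets n)

Connected : Graph → Set
Connected G = connectedᵇ (replicate (order G) true) (edges G) ≡ true

countᵇ : ∀ {A : Set} → (A → Bool) → List A → ℕ
countᵇ p xs = length (filterᵇ p xs)

f : (G : Graph) → Fin (order G) → ℕ
f G v = countᵇ (λ p → lookup (proj₁ p) v ∧ edgesInᵇ (proj₁ p) (proj₂ p)
                                        ∧ connectedᵇ (proj₁ p) (proj₂ p))
               (concatMap (λ S → map (λ es → S , es) (sublists (edges G)))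
                          (allSubsets (order G)))

-- Identifying a vertex w of H with a vertex b of K.
-- Vertices of H keep their names (inject+), the vertex b of K becomes w,
-- the other vertices of K are numbered after those of H.

embK : ∀ {n m} → Fin n → Fin m → Fin m → Fin (n + pred m)
embK {n} {suc k} w b y with b ≟ y
... | yes _  = w ↑ˡ k
... | no b≢y = n ↑ʳ punchOut b≢y

mapEdge : ∀ {a c} → (Fin a → Fin c) → Fin a × Fin a → Fin c × Fin c
mapEdge g (x , y) = g x , g y

glue : (H : Graph) → Fin (order H) → (K : Graph) → Fin (order K) → Graph
glue H w K b =
  graph (order H + pred (order K))
        (map (mapEdge (_↑ˡ pred (order K))) (edges H)
         ++ map (mapEdge (embK w b)) (edges K))

embH : (H : Graph) (K : Graph) → Fin (order H) → Fin (order H + pred (order K))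
embH H K v = v ↑ˡ pred (order K)

-- the cycle C_m on vertices 0,1,…,m-1 (edges i—i+1 and (m-1)—0); meant for m ≥ 3
cycleEdges : (m : ℕ) → List (Fin m × Fin m)
cycleEdges zero    = []
cycleEdges (suc k) = map (λ i → inject₁ i , suc i) (allFin k) ++ [ (fromℕ k , zero) ]

C : ℕ → Graph
C m = graph m (cycleEdges m)

v0 : ∀ {m} → 0 < m → Fin m
v0 p = fromℕ< p

K2 : Graph
K2 = graph 2 [ (zero , suc zero) ]

-- L_{m+1,m}: the cycle C_m with a pendant vertex attached at vertex 0
L : (m : ℕ) → 0 < m → Graph
L m p = glue (C m) (v0 p) K2 zero

cutL : (m : ℕ) (p : 0 < m) → Fin (order (L m p))
cutL m p = embH (C m) K2 (v0 p)

-- C^{m₁+m₂-1}_{m₁,m₂}: two cycles C_{m₁}, C_{m₂} sharing one vertex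
CC : (m₁ m₂ : ℕ) → 0 < m₁ → 0 < m₂ → Graph
CC m₁ m₂ p q = glue (C m₁) (v0 p) (C m₂) (v0 q)

cutCC : (m₁ m₂ : ℕ) (p : 0 < m₁) (q : 0 < m₂) → Fin (order (CC m₁ m₂ p q))
cutCC m₁ m₂ p q = embH (C m₁) (C m₂) (v0 p)

pos3 : ∀ {m} → 3 ≤ m → 0 < m
pos3 (s≤s _) = s≤s z≤n

posL : ∀ {m₁ m₂} → 3 ≤ m₁ → 3 ≤ m₂ → 0 < m₁ + m₂ ∸ 1 ∸ 1
posL {suc (suc (suc a))} {m₂} (s≤s (s≤s (s≤s _))) _ = s≤s z≤n

posN : ∀ {m₁ m₂} → 3 ≤ m₁ → 3 ≤ m₂ → 0 < m₁ + m₂ ∸ 1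
posN {suc (suc (suc a))} {m₂} (s≤s (s≤s (s≤s _))) _ = s≤s z≤n

-- For a vertex v of H, a connected subgraph of the glued graph through v restricts to a connected
-- subgraph (X , E) of H through v; if w ∈ X, its trace on the attached graph K is an arbitrary connected
-- subgraph of K through the cut vertex, and otherwise it is empty. Hence f(v) = ∑_{(X , E)} c ^ [w ∈ X]
-- with c = f_K(cut vertex), which is strictly increasing in c because H itself is such a subgraph and
-- contains w. So it suffices to compare the values of f_K at the cut vertex. There the decomposition is
-- multiplicative, giving 2 f_{C_{n₁-1}}(0) for L_{n₁,n₁-1} and f_{C_{m₁}}(0) f_{C_{m₂}}(0) for
-- C_{m₁,m₂}. Splitting on the closing edge of C_n (without it: the n subpaths through 0; with it:
-- contract it to obtain C_{n-1}) gives f_{C_n}(0) = 1 + n(n+1)/2, and the inequalities become elementary.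

module Submission where

open import Defs
open import Algebra.Properties.CommutativeSemigroup using (interchange)
open import Data.Bool using (Bool; true; false; _∧_; _∨_; not; _xor_; if_then_else_)
open import Data.Bool.ListAction using (all; any; and; or)
open import Data.Bool.Properties
  using (∧-assoc; ∨-assoc; ∧-identityʳ; ∨-identityʳ; ∧-zeroʳ; ∨-zeroʳ; ¬-not; not-injective; xor-inverseˡ; xor-same)
  renaming (_≟_ to _≟ᵇ_)
open import Data.Fin using (Fin; zero; suc; _↑ˡ_; _↑ʳ_; inject₁; fromℕ)
open import Data.Fin.Relation.Unary.Top using (view; ‵fromℕ; ‵inject₁; view-fromℕ; view-inject₁)
open import Data.List using (List; []; _∷_; [_]; _++_; map; concatMap; allFin; tabulate; null)
import Data.List.Properties as List
open import Data.List.Membership.Propositional using (_∈_)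
open import Data.List.Membership.Propositional.Properties using (∈-concatMap⁺)
open import Data.List.Relation.Unary.Any using (here; there)
import Data.List.Relation.Unary.Any as Any
open import Data.Nat using (ℕ; zero; suc; _+_; _*_; _∸_; _≤_; _<_; s≤s; z≤n)
open import Data.Nat.ListAction using (sum)
open import Data.Nat.ListAction.Properties using (sum-++)
open import Data.Nat.Properties
open import Data.Nat.Tactic.RingSolver using (solve-∀)
open import Data.Product using (_×_; _,_; proj₁; proj₂; ∃-syntax)
open import Data.Sum using (_⊎_; inj₁; inj₂)
open import Data.Vec using (Vec; []; _∷_; lookup; _∷ʳ_) renaming (_++_ to _++ᵛ_)
import Data.Vec as Vec
import Data.Vec.Properties as Vec
open import Function using (_∘_; _∘′_; id)
open import Relation.Binary.PropositionalEquality hiding ([_])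
open import Relation.Nullary using (yes; no; contradiction)

private variable
  A B : Set

∧-true : ∀ {a b} → a ∧ b ≡ true → a ≡ true × b ≡ true
∧-true {true} e = refl , e

∨-true : ∀ {a b} → a ∨ b ≡ true → a ≡ true ⊎ b ≡ true
∨-true {true}  _ = inj₁ refl
∨-true {false} e = inj₂ e

∨-resolveˡ : ∀ {a b} → a ∨ b ≡ true → b ≡ false → a ≡ true
∨-resolveˡ {true}  _ _ = refl
∨-resolveˡ {false} refl ()

∨-resolveʳ : ∀ {a b} → a ∨ b ≡ true → a ≡ false → b ≡ true
∨-resolveʳ {false} b refl = b

bool-ext : ∀ {a b} → (a ≡ true → b ≡ true) → (b ≡ true → a ≡ true) → a ≡ b
bool-ext {true}  a⇒b b⇒a = sym (a⇒b refl)
bool-ext {false} {true}  a⇒b b⇒a = b⇒a refl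
bool-ext {false} {false} a⇒b b⇒a = refl

xor-≢ : ∀ {a b} → a ≢ b → a xor b ≡ true
xor-≢ {a} {b} a≢b = trans (cong (_xor b) (¬-not a≢b)) (xor-inverseˡ b)

any-++ : (p : A → Bool) (xs ys : List A) → any p (xs ++ ys) ≡ any p xs ∨ any p ys
any-++ p []       ys = refl
any-++ p (x ∷ xs) ys = trans (cong (p x ∨_) (any-++ p xs ys)) (sym (∨-assoc (p x) _ _))

all-++ : (p : A → Bool) (xs ys : List A) → all p (xs ++ ys) ≡ all p xs ∧ all p ys
all-++ p []       ys = refl
all-++ p (x ∷ xs) ys = trans (cong (p x ∧_) (all-++ p xs ys)) (sym (∧-assoc (p x) _ _))

any-map : (p : B → Bool) (h : A → B) (xs : List A) → any p (map h xs) ≡ any (p ∘ h) xs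
any-map p h xs = cong or (sym (List.map-∘ xs))

all-map : (p : B → Bool) (h : A → B) (xs : List A) → all p (map h xs) ≡ all (p ∘ h) xs
all-map p h xs = cong and (sym (List.map-∘ xs))

any-cong : {p q : A → Bool} → (∀ x → p x ≡ q x) → (xs : List A) → any p xs ≡ any q xs
any-cong p≗q xs = cong or (List.map-cong p≗q xs)

all-cong : {p q : A → Bool} → (∀ x → p x ≡ q x) → (xs : List A) → all p xs ≡ all q xs
all-cong p≗q xs = cong and (List.map-cong p≗q xs)

all-concatMap : (p : B → Bool) (h : A → List B) (xs : List A) →
                all p (concatMap h xs) ≡ all (λ x → all p (h x)) xs
all-concatMap p h []       = refl
all-concatMap p h (x ∷ xs) = trans (all-++ p (h x) (concatMap h xs)) (cong (all p (h x) ∧_) (all-concatMap p h xs))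

any-tabulate⁺ : ∀ {n} (h : Fin n → A) (p : A → Bool) i → p (h i) ≡ true → any p (tabulate h) ≡ true
any-tabulate⁺ h p zero    e = cong (_∨ any p (tabulate (h ∘ suc))) e
any-tabulate⁺ h p (suc i) e =
  trans (cong (p (h zero) ∨_) (any-tabulate⁺ (h ∘ suc) p i e)) (∨-zeroʳ (p (h zero)))

any-tabulate⁻ : ∀ {n} (h : Fin n → A) (p : A → Bool) → any p (tabulate h) ≡ true → ∃[ i ] p (h i) ≡ true
any-tabulate⁻ {n = suc n} h p e with ∨-true {p (h zero)} e
... | inj₁ e₀ = zero , e₀
... | inj₂ e₁ with any-tabulate⁻ (h ∘ suc) p e₁
...   | i , eᵢ = suc i , eᵢ

all-tabulate⁺ : ∀ {n} (h : Fin n → A) (p : A → Bool) → (∀ i → p (h i) ≡ true) → all p (tabulate h) ≡ true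
all-tabulate⁺ {n = zero}  h p e = refl
all-tabulate⁺ {n = suc n} h p e = cong₂ _∧_ (e zero) (all-tabulate⁺ (h ∘ suc) p (e ∘ suc))

all-tabulate⁻ : ∀ {n} (h : Fin n → A) (p : A → Bool) → all p (tabulate h) ≡ true → ∀ i → p (h i) ≡ true
all-tabulate⁻ h p e zero    = proj₁ (∧-true e)
all-tabulate⁻ h p e (suc i) = all-tabulate⁻ (h ∘ suc) p (proj₂ (∧-true e)) i

tabulate-∷ʳ : ∀ n (h : Fin (suc n) → A) → tabulate h ≡ tabulate (h ∘ inject₁) ++ [ h (fromℕ n) ]
tabulate-∷ʳ zero    h = refl
tabulate-∷ʳ (suc n) h = cong (h zero ∷_) (tabulate-∷ʳ n (h ∘ suc))

lookup-∷ʳ-inject₁ : ∀ {n} (S : Vec A n) x (i : Fin n) → lookup (S ∷ʳ x) (inject₁ i) ≡ lookup S i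
lookup-∷ʳ-inject₁ (s ∷ S) x zero    = refl
lookup-∷ʳ-inject₁ (s ∷ S) x (suc i) = lookup-∷ʳ-inject₁ S x i

lookup-∷ʳ-fromℕ : ∀ {n} (S : Vec A n) x → lookup (S ∷ʳ x) (fromℕ n) ≡ x
lookup-∷ʳ-fromℕ []      x = refl
lookup-∷ʳ-fromℕ (s ∷ S) x = lookup-∷ʳ-fromℕ S x

null-true : {xs : List A} → null xs ≡ true → xs ≡ []
null-true {xs = []} _ = refl

+-interchange : ∀ a b c d → (a + b) + (c + d) ≡ (a + c) + (b + d)
+-interchange = interchange +-commutativeSemigroup

∑ : List A → (A → ℕ) → ℕ
∑ xs g = sum (map g xs)

syntax ∑ xs (λ x → e) = ∑[ x ∈ xs ] e

⟦_⟧ : Bool → ℕ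
⟦ true  ⟧ = 1
⟦ false ⟧ = 0

⟦∧⟧ : ∀ a b → ⟦ a ∧ b ⟧ ≡ ⟦ a ⟧ * ⟦ b ⟧
⟦∧⟧ true  b = sym (+-identityʳ ⟦ b ⟧)
⟦∧⟧ false b = refl

countᵇ≡∑ : (p : A → Bool) (xs : List A) → countᵇ p xs ≡ ∑[ x ∈ xs ] ⟦ p x ⟧
countᵇ≡∑ p []       = refl
countᵇ≡∑ p (x ∷ xs) with p x
... | true  = cong suc (countᵇ≡∑ p xs)
... | false = countᵇ≡∑ p xs

∑-cong : {g h : A → ℕ} → (∀ x → g x ≡ h x) → (xs : List A) → ∑ xs g ≡ ∑ xs h
∑-cong g≗h xs = cong sum (List.map-cong g≗h xs)

∑-zero : (xs : List A) → ∑[ x ∈ xs ] 0 ≡ 0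
∑-zero []       = refl
∑-zero (x ∷ xs) = ∑-zero xs

+-∑-zero : ∀ m (xs : List A) → m + ∑[ x ∈ xs ] 0 ≡ m
+-∑-zero m xs = trans (cong (m +_) (∑-zero xs)) (+-identityʳ m)

∑-++ : (xs ys : List A) (g : A → ℕ) → ∑ (xs ++ ys) g ≡ ∑ xs g + ∑ ys g
∑-++ xs ys g = trans (cong sum (List.map-++ g xs ys)) (sum-++ (map g xs) (map g ys))

∑-map : (h : A → B) (xs : List A) (g : B → ℕ) → ∑ (map h xs) g ≡ ∑ xs (g ∘ h)
∑-map h xs g = cong sum (sym (List.map-∘ xs))

∑-concatMap : (h : A → List B) (xs : List A) (g : B → ℕ) →
              ∑ (concatMap h xs) g ≡ ∑[ x ∈ xs ] ∑ (h x) g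
∑-concatMap h []       g = refl
∑-concatMap h (x ∷ xs) g = trans (∑-++ (h x) (concatMap h xs) g) (cong (∑ (h x) g +_) (∑-concatMap h xs g))

∑-distrib-+ : (xs : List A) (g h : A → ℕ) → ∑[ x ∈ xs ] (g x + h x) ≡ ∑ xs g + ∑ xs h
∑-distrib-+ []       g h = refl
∑-distrib-+ (x ∷ xs) g h =
  trans (cong (g x + h x +_) (∑-distrib-+ xs g h)) (+-interchange (g x) (h x) _ _)

*-distribˡ-∑ : (c : ℕ) (xs : List A) (g : A → ℕ) → c * ∑ xs g ≡ ∑[ x ∈ xs ] (c * g x)
*-distribˡ-∑ c []       g = *-zeroʳ c
*-distribˡ-∑ c (x ∷ xs) g = trans (*-distribˡ-+ c (g x) _) (cong (c * g x +_) (*-distribˡ-∑ c xs g))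

∑-comm : (xs : List A) (ys : List B) (g : A → B → ℕ) →
         ∑[ x ∈ xs ] ∑ ys (g x) ≡ ∑[ y ∈ ys ] ∑[ x ∈ xs ] g x y
∑-comm []       ys g = sym (∑-zero ys)
∑-comm (x ∷ xs) ys g = trans (cong (∑ ys (g x) +_) (∑-comm xs ys g)) (sym (∑-distrib-+ ys (g x) _))

∑-mono-≤ : {g h : A → ℕ} → (∀ x → g x ≤ h x) → (xs : List A) → ∑ xs g ≤ ∑ xs h
∑-mono-≤ g≤h []       = z≤n
∑-mono-≤ g≤h (x ∷ xs) = +-mono-≤ (g≤h x) (∑-mono-≤ g≤h xs)

∑-mono-< : {g h : A → ℕ} → (∀ x → g x ≤ h x) → {x : A} {xs : List A} → x ∈ xs → g x < h x → ∑ xs g < ∑ xs h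
∑-mono-< g≤h {xs = _ ∷ xs} (here refl)  gx<hx = +-mono-<-≤ gx<hx (∑-mono-≤ g≤h xs)
∑-mono-< g≤h {xs = y ∷ _}  (there x∈xs) gx<hx = +-mono-≤-< (g≤h y) (∑-mono-< g≤h x∈xs gx<hx)

full∈allSubsets : ∀ n → Vec.replicate n true ∈ allSubsets n
full∈allSubsets zero    = here refl
full∈allSubsets (suc n) =
  ∈-concatMap⁺ (λ X → (true ∷ X) ∷ (false ∷ X) ∷ []) (Any.map (λ { refl → here refl }) (full∈allSubsets n))

xs∈sublists : (xs : List A) → xs ∈ sublists xs
xs∈sublists []       = here refl
xs∈sublists (x ∷ xs) =
  ∈-concatMap⁺ (λ ys → (x ∷ ys) ∷ ys ∷ []) (Any.map (λ { refl → here refl }) (xs∈sublists xs))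

∑-allSubsets-suc : ∀ n (g : Vec Bool (suc n) → ℕ) →
  ∑ (allSubsets (suc n)) g ≡ ∑[ X ∈ allSubsets n ] (g (true ∷ X) + g (false ∷ X))
∑-allSubsets-suc n g = trans (∑-concatMap _ (allSubsets n) g)
  (∑-cong (λ X → cong (g (true ∷ X) +_) (+-identityʳ _)) (allSubsets n))

∑-allSubsets-++ : ∀ a k (g : Vec Bool (a + k) → ℕ) →
  ∑ (allSubsets (a + k)) g ≡ ∑[ X ∈ allSubsets a ] ∑[ Y ∈ allSubsets k ] g (X ++ᵛ Y)
∑-allSubsets-++ zero    k g = sym (+-identityʳ _)
∑-allSubsets-++ (suc a) k g = begin
  ∑ (allSubsets (suc a + k)) g
    ≡⟨ ∑-allSubsets-suc (a + k) g ⟩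
  ∑[ Z ∈ allSubsets (a + k) ] (g (true ∷ Z) + g (false ∷ Z))
    ≡⟨ ∑-allSubsets-++ a k _ ⟩
  ∑[ X ∈ allSubsets a ] ∑[ Y ∈ allSubsets k ] (g (true ∷ X ++ᵛ Y) + g (false ∷ X ++ᵛ Y))
    ≡⟨ ∑-cong (λ X → ∑-distrib-+ (allSubsets k) _ _) (allSubsets a) ⟩
  ∑[ X ∈ allSubsets a ] (∑[ Y ∈ allSubsets k ] g (true ∷ X ++ᵛ Y) + ∑[ Y ∈ allSubsets k ] g (false ∷ X ++ᵛ Y))
    ≡⟨ ∑-allSubsets-suc a _ ⟨
  ∑[ X ∈ allSubsets (suc a) ] ∑[ Y ∈ allSubsets k ] g (X ++ᵛ Y) ∎
  where open ≡-Reasoning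

∑-allSubsets-∷ʳ : ∀ n (g : Vec Bool (suc n) → ℕ) →
  ∑ (allSubsets (suc n)) g ≡ ∑[ X ∈ allSubsets n ] (g (X ∷ʳ true) + g (X ∷ʳ false))
∑-allSubsets-∷ʳ zero    g = sym (+-assoc (g (true ∷ [])) (g (false ∷ [])) 0)
∑-allSubsets-∷ʳ (suc n) g = begin
  ∑ (allSubsets (suc (suc n))) g
    ≡⟨ ∑-allSubsets-suc (suc n) g ⟩
  ∑[ Z ∈ allSubsets (suc n) ] (g (true ∷ Z) + g (false ∷ Z))
    ≡⟨ ∑-allSubsets-∷ʳ n _ ⟩
  ∑[ X ∈ allSubsets n ] ((g (true ∷ (X ∷ʳ true)) + g (false ∷ (X ∷ʳ true)))
                        + (g (true ∷ (X ∷ʳ false)) + g (false ∷ (X ∷ʳ false))))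
    ≡⟨ ∑-cong (λ X → +-interchange (g (true ∷ (X ∷ʳ true))) (g (false ∷ (X ∷ʳ true)))
                                     (g (true ∷ (X ∷ʳ false))) (g (false ∷ (X ∷ʳ false))))
             (allSubsets n) ⟩
  ∑[ X ∈ allSubsets n ] ((g (true ∷ (X ∷ʳ true)) + g (true ∷ (X ∷ʳ false)))
                        + (g (false ∷ (X ∷ʳ true)) + g (false ∷ (X ∷ʳ false))))
    ≡⟨ ∑-allSubsets-suc n _ ⟨
  ∑[ X ∈ allSubsets (suc n) ] (g (X ∷ʳ true) + g (X ∷ʳ false)) ∎
  where open ≡-Reasoning

∑-sublists-++ : (xs ys : List A) (g : List A → ℕ) →
  ∑ (sublists (xs ++ ys)) g ≡ ∑[ E₁ ∈ sublists xs ] ∑[ E₂ ∈ sublists ys ] g (E₁ ++ E₂)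
∑-sublists-++ []       ys g = sym (+-identityʳ _)
∑-sublists-++ (x ∷ xs) ys g = begin
  ∑ (sublists (x ∷ xs ++ ys)) g
    ≡⟨ ∑-concatMap _ (sublists (xs ++ ys)) g ⟩
  ∑[ Z ∈ sublists (xs ++ ys) ] (g (x ∷ Z) + (g Z + 0))
    ≡⟨ ∑-sublists-++ xs ys _ ⟩
  ∑[ E₁ ∈ sublists xs ] ∑[ E₂ ∈ sublists ys ] (g (x ∷ E₁ ++ E₂) + (g (E₁ ++ E₂) + 0))
    ≡⟨ ∑-cong (λ E₁ → ∑-distrib-+ (sublists ys) _ _) (sublists xs) ⟩
  ∑[ E₁ ∈ sublists xs ] (∑[ E₂ ∈ sublists ys ] g (x ∷ E₁ ++ E₂) + ∑[ E₂ ∈ sublists ys ] (g (E₁ ++ E₂) + 0))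
    ≡⟨ ∑-cong (λ E₁ → cong (∑[ E₂ ∈ sublists ys ] g (x ∷ E₁ ++ E₂) +_) (split E₁)) (sublists xs) ⟩
  ∑[ E₁ ∈ sublists xs ] (∑[ E₂ ∈ sublists ys ] g (x ∷ E₁ ++ E₂) + (∑[ E₂ ∈ sublists ys ] g (E₁ ++ E₂) + 0))
    ≡⟨ ∑-concatMap _ (sublists xs) _ ⟨
  ∑[ E₁ ∈ sublists (x ∷ xs) ] ∑[ E₂ ∈ sublists ys ] g (E₁ ++ E₂) ∎
  where
  open ≡-Reasoning
  split : ∀ E₁ → ∑[ E₂ ∈ sublists ys ] (g (E₁ ++ E₂) + 0) ≡ ∑[ E₂ ∈ sublists ys ] g (E₁ ++ E₂) + 0
  split E₁ = trans (∑-cong (λ E₂ → +-identityʳ _) (sublists ys)) (sym (+-identityʳ _))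

∑-sublists-∷ʳ : (xs : List A) (x : A) (g : List A → ℕ) →
  ∑ (sublists (xs ++ [ x ])) g ≡ ∑[ E ∈ sublists xs ] g (E ++ [ x ]) + ∑ (sublists xs) g
∑-sublists-∷ʳ xs x g = trans (∑-sublists-++ xs [ x ] g)
  (trans (∑-cong (λ E → cong (g (E ++ [ x ]) +_) (trans (+-identityʳ _) (cong g (List.++-identityʳ E)))) (sublists xs))
         (∑-distrib-+ (sublists xs) _ g))

∑-sublists-map : (h : A → B) (xs : List A) (g : List B → ℕ) →
  ∑ (sublists (map h xs)) g ≡ ∑[ E ∈ sublists xs ] g (map h E)
∑-sublists-map h []       g = refl
∑-sublists-map h (x ∷ xs) g =
  trans (∑-concatMap _ (sublists (map h xs)) g)
  (trans (∑-sublists-map h xs (λ Z → g (h x ∷ Z) + (g Z + 0)))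
  (sym (∑-concatMap _ (sublists xs) _)))

∑-sublists-null : (xs : List A) → ∑[ E ∈ sublists xs ] ⟦ null E ⟧ ≡ 1
∑-sublists-null []       = refl
∑-sublists-null (x ∷ xs) =
  trans (∑-concatMap _ (sublists xs) _) (trans (∑-cong (λ _ → +-identityʳ _) (sublists xs)) (∑-sublists-null xs))

all-allSubsets⁺ : ∀ n (p : Vec Bool n → Bool) → (∀ T → p T ≡ true) → all p (allSubsets n) ≡ true
all-allSubsets⁺ zero    p e = cong (_∧ true) (e [])
all-allSubsets⁺ (suc n) p e = trans (all-concatMap p _ (allSubsets n))
  (all-allSubsets⁺ n _ λ T → cong₂ _∧_ (e (true ∷ T)) (cong (_∧ true) (e (false ∷ T))))

all-allSubsets⁻ : ∀ n (p : Vec Bool n → Bool) → all p (allSubsets n) ≡ true → ∀ T → p T ≡ true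
all-allSubsets⁻ zero    p e []  = proj₁ (∧-true e)
all-allSubsets⁻ (suc n) p e (b ∷ T)
  with ∧-true {p (true ∷ T)} (all-allSubsets⁻ n (λ s → p (true ∷ s) ∧ (p (false ∷ s) ∧ true))
                                (trans (sym (all-concatMap p _ (allSubsets n))) e) T)
... | p[true∷T] , p[false∷T]∧true with b
...   | true  = p[true∷T]
...   | false = proj₁ (∧-true {p (false ∷ T)} p[false∷T]∧true)

-- Connectivity through cuts

module _ {n : ℕ} where

  _⊆_ : Vec Bool n → Vec Bool n → Set
  T ⊆ S = ∀ i → lookup T i ≡ true → lookup S i ≡ true

  _⊈_ : Vec Bool n → Vec Bool n → Set
  S ⊈ T = ∃[ i ] lookup S i ≡ true × lookup T i ≡ false

  NonEmpty : Vec Bool n → Set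
  NonEmpty T = ∃[ i ] lookup T i ≡ true

  CutsCrossed : Vec Bool n → List (Fin n × Fin n) → Set
  CutsCrossed S E = ∀ T → T ⊆ S → NonEmpty T → S ⊈ T → crossesᵇ T E ≡ true

  nonemptyᵇ⁺ : (T : Vec Bool n) → NonEmpty T → nonemptyᵇ T ≡ true
  nonemptyᵇ⁺ T (i , Tᵢ) = any-tabulate⁺ id (lookup T) i Tᵢ

  nonemptyᵇ⁻ : (T : Vec Bool n) → nonemptyᵇ T ≡ true → NonEmpty T
  nonemptyᵇ⁻ T = any-tabulate⁻ id (lookup T)

  subsetᵇ⁺ : (T S : Vec Bool n) → T ⊆ S → subsetᵇ T S ≡ true
  subsetᵇ⁺ T S T⊆S = all-tabulate⁺ id _ λ i → implies (lookup T i) (T⊆S i)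
    where
    implies : ∀ a {b} → (a ≡ true → b ≡ true) → not a ∨ b ≡ true
    implies true  a⇒b = a⇒b refl
    implies false a⇒b = refl

  subsetᵇ⁻ : (T S : Vec Bool n) → subsetᵇ T S ≡ true → T ⊆ S
  subsetᵇ⁻ T S e i Tᵢ = implied (lookup T i) (all-tabulate⁻ id _ e i) Tᵢ
    where
    implied : ∀ a {b} → not a ∨ b ≡ true → a ≡ true → b ≡ true
    implied true ¬a∨b refl = ¬a∨b

  properᵇ⁺ : (T S : Vec Bool n) → S ⊈ T → properᵇ T S ≡ true
  properᵇ⁺ T S (i , Sᵢ , Tᵢ) = any-tabulate⁺ id _ i (cong₂ (λ a b → a ∧ not b) Sᵢ Tᵢ)

  properᵇ⁻ : (T S : Vec Bool n) → properᵇ T S ≡ true → S ⊈ T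
  properᵇ⁻ T S e with any-tabulate⁻ id _ e
  ... | i , eᵢ = i , split (lookup S i) (lookup T i) eᵢ
    where
    split : ∀ a b → a ∧ not b ≡ true → a ≡ true × b ≡ false
    split true false _ = refl , refl

  properᵇ-false : (T S : Vec Bool n) → properᵇ T S ≡ false → S ⊆ T
  properᵇ-false T S e i Sᵢ with lookup T i in Tᵢ
  ... | true  = refl
  ... | false = contradiction (trans (sym (properᵇ⁺ T S (i , Sᵢ , Tᵢ))) e) λ ()

  connectedᵇ⁺ : (S : Vec Bool n) (E : List (Fin n × Fin n)) → NonEmpty S → CutsCrossed S E → connectedᵇ S E ≡ true
  connectedᵇ⁺ S E neS cuts = cong₂ _∧_ (nonemptyᵇ⁺ S neS) (all-allSubsets⁺ n _ crossed)
    where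
    crossed : ∀ T → not (subsetᵇ T S ∧ nonemptyᵇ T ∧ properᵇ T S) ∨ crossesᵇ T E ≡ true
    crossed T with subsetᵇ T S in ⊆ᵇ | nonemptyᵇ T in neᵇ | properᵇ T S in ⊈ᵇ
    ... | true  | true  | true  = cuts T (subsetᵇ⁻ T S ⊆ᵇ) (nonemptyᵇ⁻ T neᵇ) (properᵇ⁻ T S ⊈ᵇ)
    ... | true  | true  | false = refl
    ... | true  | false | _     = refl
    ... | false | _     | _     = refl

  connectedᵇ⁻ : (S : Vec Bool n) (E : List (Fin n × Fin n)) → connectedᵇ S E ≡ true → NonEmpty S × CutsCrossed S E
  connectedᵇ⁻ S E e with ∧-true e
  ... | neᵇ , crossed = nonemptyᵇ⁻ S neᵇ , λ T T⊆S neT S⊈T →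
    crossing (all-allSubsets⁻ n _ crossed T) (subsetᵇ⁺ T S T⊆S) (nonemptyᵇ⁺ T neT) (properᵇ⁺ T S S⊈T)
    where
    crossing : ∀ {a b c d} → not (a ∧ b ∧ c) ∨ d ≡ true → a ≡ true → b ≡ true → c ≡ true → d ≡ true
    crossing d refl refl refl = d

module _ {n : ℕ} where

  Empty : Vec Bool n → Set
  Empty T = ∀ i → lookup T i ≡ false

  ∅ : Vec Bool n
  ∅ = Vec.replicate n false

  ∅-Empty : Empty ∅
  ∅-Empty i = Vec.lookup-replicate i false

  ∅⊆ : (S : Vec Bool n) → ∅ ⊆ S
  ∅⊆ S i ∅ᵢ = contradiction (trans (sym ∅ᵢ) (∅-Empty i)) λ ()

  nonemptyᵇ-Empty : (T : Vec Bool n) → Empty T → nonemptyᵇ T ≡ false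
  nonemptyᵇ-Empty T empty with nonemptyᵇ T in neᵇ
  ... | false = refl
  ... | true  = let (i , Tᵢ) = nonemptyᵇ⁻ T neᵇ in contradiction (trans (sym Tᵢ) (empty i)) λ ()

  nonemptyᵇ-∷ : ∀ b (T : Vec Bool n) → nonemptyᵇ (b ∷ T) ≡ b ∨ nonemptyᵇ T
  nonemptyᵇ-∷ b T = cong (λ bs → b ∨ or bs)
    (trans (List.map-tabulate suc (lookup (b ∷ T))) (sym (List.map-tabulate id (lookup T))))

  nonemptyᵇ-false : (T : Vec Bool n) → nonemptyᵇ T ≡ false → Empty T
  nonemptyᵇ-false T e i with lookup T i in Tᵢ
  ... | true  = contradiction (trans (sym (nonemptyᵇ⁺ T (i , Tᵢ))) e) λ ()
  ... | false = refl

  crossesᵇ-Empty : (T : Vec Bool n) → Empty T → (E : List (Fin n × Fin n)) → crossesᵇ T E ≡ false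
  crossesᵇ-Empty T empty []            = refl
  crossesᵇ-Empty T empty ((x , y) ∷ E) rewrite empty x | empty y = crossesᵇ-Empty T empty E

  crossesᵇ-inside : (T : Vec Bool n) (E : List (Fin n × Fin n)) → edgesInᵇ T E ≡ true → crossesᵇ T E ≡ false
  crossesᵇ-inside T []            _ = refl
  crossesᵇ-inside T ((x , y) ∷ E) inside with lookup T x | lookup T y
  ... | true | true = crossesᵇ-inside T E inside

  edgesInᵇ-Empty : (T : Vec Bool n) → Empty T → (E : List (Fin n × Fin n)) → edgesInᵇ T E ≡ true → E ≡ []
  edgesInᵇ-Empty T empty []            _      = refl
  edgesInᵇ-Empty T empty ((x , y) ∷ E) inside rewrite empty x = contradiction inside λ ()

↑-view : ∀ a {k} (i : Fin (a + k)) → (∃[ j ] i ≡ j ↑ˡ k) ⊎ (∃[ j ] i ≡ a ↑ʳ j)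
↑-view zero    i       = inj₂ (i , refl)
↑-view (suc a) zero    = inj₁ (zero , refl)
↑-view (suc a) (suc i) with ↑-view a i
... | inj₁ (j , i≡j) = inj₁ (suc j , cong suc i≡j)
... | inj₂ (j , i≡j) = inj₂ (j , cong suc i≡j)

module _ {a k : ℕ} (TX X : Vec Bool a) (TY Y : Vec Bool k) where

  ⊆-++⁺ : TX ⊆ X → TY ⊆ Y → (TX ++ᵛ TY) ⊆ (X ++ᵛ Y)
  ⊆-++⁺ TX⊆X TY⊆Y i Tᵢ with ↑-view a i
  ... | inj₁ (j , refl) = trans (Vec.lookup-++ˡ X Y j) (TX⊆X j (trans (sym (Vec.lookup-++ˡ TX TY j)) Tᵢ))
  ... | inj₂ (j , refl) = trans (Vec.lookup-++ʳ X Y j) (TY⊆Y j (trans (sym (Vec.lookup-++ʳ TX TY j)) Tᵢ))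

  ⊆-++⁻ : (TX ++ᵛ TY) ⊆ (X ++ᵛ Y) → TX ⊆ X × TY ⊆ Y
  ⊆-++⁻ T⊆S = (λ j TXⱼ → trans (sym (Vec.lookup-++ˡ X Y j)) (T⊆S (j ↑ˡ k) (trans (Vec.lookup-++ˡ TX TY j) TXⱼ)))
            , (λ j TYⱼ → trans (sym (Vec.lookup-++ʳ X Y j)) (T⊆S (a ↑ʳ j) (trans (Vec.lookup-++ʳ TX TY j) TYⱼ)))

  ⊈-++ˡ : X ⊈ TX → (X ++ᵛ Y) ⊈ (TX ++ᵛ TY)
  ⊈-++ˡ (j , Xⱼ , TXⱼ) = j ↑ˡ k , trans (Vec.lookup-++ˡ X Y j) Xⱼ , trans (Vec.lookup-++ˡ TX TY j) TXⱼ

  ⊈-++ʳ : Y ⊈ TY → (X ++ᵛ Y) ⊈ (TX ++ᵛ TY)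
  ⊈-++ʳ (j , Yⱼ , TYⱼ) = a ↑ʳ j , trans (Vec.lookup-++ʳ X Y j) Yⱼ , trans (Vec.lookup-++ʳ TX TY j) TYⱼ

  ⊈-++⁻ : (X ++ᵛ Y) ⊈ (TX ++ᵛ TY) → X ⊈ TX ⊎ Y ⊈ TY
  ⊈-++⁻ (i , Sᵢ , Tᵢ) with ↑-view a i
  ... | inj₁ (j , refl) = inj₁ (j , trans (sym (Vec.lookup-++ˡ X Y j)) Sᵢ , trans (sym (Vec.lookup-++ˡ TX TY j)) Tᵢ)
  ... | inj₂ (j , refl) = inj₂ (j , trans (sym (Vec.lookup-++ʳ X Y j)) Sᵢ , trans (sym (Vec.lookup-++ʳ TX TY j)) Tᵢ)

module _ {a k : ℕ} (TX : Vec Bool a) (TY : Vec Bool k) where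

  NonEmpty-++ˡ : NonEmpty TX → NonEmpty (TX ++ᵛ TY)
  NonEmpty-++ˡ (j , TXⱼ) = j ↑ˡ k , trans (Vec.lookup-++ˡ TX TY j) TXⱼ

  NonEmpty-++ʳ : NonEmpty TY → NonEmpty (TX ++ᵛ TY)
  NonEmpty-++ʳ (j , TYⱼ) = a ↑ʳ j , trans (Vec.lookup-++ʳ TX TY j) TYⱼ

  NonEmpty-++⁻ : NonEmpty (TX ++ᵛ TY) → NonEmpty TX ⊎ NonEmpty TY
  NonEmpty-++⁻ (i , Tᵢ) with ↑-view a i
  ... | inj₁ (j , refl) = inj₁ (j , trans (sym (Vec.lookup-++ˡ TX TY j)) Tᵢ)
  ... | inj₂ (j , refl) = inj₂ (j , trans (sym (Vec.lookup-++ʳ TX TY j)) Tᵢ)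

edgesInᵇ-full : ∀ {n} (E : List (Fin n × Fin n)) → edgesInᵇ (Vec.replicate n true) E ≡ true
edgesInᵇ-full []            = refl
edgesInᵇ-full ((x , y) ∷ E)
  rewrite Vec.lookup-replicate x true | Vec.lookup-replicate y true = edgesInᵇ-full E

module _ {n n′ : ℕ} (π : Fin n → Fin n′) (T′ : Vec Bool n′) (T : Vec Bool n)
         (T≗T′∘π : ∀ i → lookup T i ≡ lookup T′ (π i)) where

  crossesᵇ-map : (E : List (Fin n × Fin n)) → crossesᵇ T′ (map (mapEdge π) E) ≡ crossesᵇ T E
  crossesᵇ-map E = trans (any-map _ (mapEdge π) E)
    (any-cong (λ e → sym (cong₂ _xor_ (T≗T′∘π (proj₁ e)) (T≗T′∘π (proj₂ e)))) E)

  edgesInᵇ-map : (E : List (Fin n × Fin n)) → edgesInᵇ T′ (map (mapEdge π) E) ≡ edgesInᵇ T E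
  edgesInᵇ-map E = trans (all-map _ (mapEdge π) E)
    (all-cong (λ e → sym (cong₂ _∧_ (T≗T′∘π (proj₁ e)) (T≗T′∘π (proj₂ e)))) E)

module _ {n : ℕ} (T : Vec Bool n) (E : List (Fin n × Fin n)) (x y : Fin n) where

  crossesᵇ-∷ʳ : crossesᵇ T (E ++ [ (x , y) ]) ≡ crossesᵇ T E ∨ (lookup T x xor lookup T y)
  crossesᵇ-∷ʳ = trans (any-++ _ E _) (cong (crossesᵇ T E ∨_) (∨-identityʳ _))

  edgesInᵇ-∷ʳ : edgesInᵇ T (E ++ [ (x , y) ]) ≡ edgesInᵇ T E ∧ (lookup T x ∧ lookup T y)
  edgesInᵇ-∷ʳ = trans (all-++ _ E _) (cong (edgesInᵇ T E ∧_) (∧-identityʳ _))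

-- π contracts the edge (x , y): it identifies x with y and nothing else.
module Contraction {n n′ : ℕ} (π : Fin n → Fin n′) (σ : Fin n′ → Fin n) (π∘σ : ∀ j → π (σ j) ≡ j)
  (x y : Fin n) (πx≡πy : π x ≡ π y)
  (fibres : ∀ (T : Vec Bool n) → lookup T x ≡ lookup T y → ∀ i → lookup T (σ (π i)) ≡ lookup T i)
  (S′ : Vec Bool n′) (S : Vec Bool n) (S≗S′∘π : ∀ i → lookup S i ≡ lookup S′ (π i))
  (E : List (Fin n × Fin n)) where

  private
    S′≗S∘σ : ∀ j → lookup S′ j ≡ lookup S (σ j)
    S′≗S∘σ j = sym (trans (S≗S′∘π (σ j)) (cong (lookup S′) (π∘σ j)))

  connectedᵇ-contract⁻ : connectedᵇ S′ (map (mapEdge π) E) ≡ true → connectedᵇ S (E ++ [ (x , y) ]) ≡ true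
  connectedᵇ-contract⁻ c with connectedᵇ⁻ S′ (map (mapEdge π) E) c
  ... | (j , S′ⱼ) , cuts′ = connectedᵇ⁺ S (E ++ [ (x , y) ]) (σ j , trans (sym (S′≗S∘σ j)) S′ⱼ) cuts
    where
    cuts : CutsCrossed S (E ++ [ (x , y) ])
    cuts T T⊆S neT S⊈T with lookup T x ≟ᵇ lookup T y
    ... | no Tx≢Ty = trans (crossesᵇ-∷ʳ T E x y) (trans (cong (crossesᵇ T E ∨_) (xor-≢ Tx≢Ty)) (∨-zeroʳ _))
    ... | yes Tx≡Ty = trans (crossesᵇ-∷ʳ T E x y) (cong (_∨ (lookup T x xor lookup T y)) crossesE)
      where
      T′ : Vec Bool n′
      T′ = Vec.tabulate (lookup T ∘ σ)
      T′≗T∘σ : ∀ j → lookup T′ j ≡ lookup T (σ j)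
      T′≗T∘σ = Vec.lookup∘tabulate _
      T≗T′∘π : ∀ i → lookup T i ≡ lookup T′ (π i)
      T≗T′∘π i = sym (trans (T′≗T∘σ (π i)) (fibres T Tx≡Ty i))
      T′⊆S′ : T′ ⊆ S′
      T′⊆S′ j T′ⱼ = trans (S′≗S∘σ j) (T⊆S (σ j) (trans (sym (T′≗T∘σ j)) T′ⱼ))
      neT′ : NonEmpty T′
      neT′ = let (i , Tᵢ) = neT in π i , trans (sym (T≗T′∘π i)) Tᵢ
      S′⊈T′ : S′ ⊈ T′
      S′⊈T′ = let (i , Sᵢ , Tᵢ) = S⊈T in π i , trans (sym (S≗S′∘π i)) Sᵢ , trans (sym (T≗T′∘π i)) Tᵢ
      crossesE : crossesᵇ T E ≡ true
      crossesE = trans (sym (crossesᵇ-map π T′ T T≗T′∘π E)) (cuts′ T′ T′⊆S′ neT′ S′⊈T′)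

  connectedᵇ-contract⁺ : connectedᵇ S (E ++ [ (x , y) ]) ≡ true → connectedᵇ S′ (map (mapEdge π) E) ≡ true
  connectedᵇ-contract⁺ c with connectedᵇ⁻ S (E ++ [ (x , y) ]) c
  ... | (i , Sᵢ) , cuts = connectedᵇ⁺ S′ (map (mapEdge π) E) (π i , trans (sym (S≗S′∘π i)) Sᵢ) cuts′
    where
    cuts′ : CutsCrossed S′ (map (mapEdge π) E)
    cuts′ T′ T′⊆S′ neT′ S′⊈T′ = trans (crossesᵇ-map π T′ T T≗T′∘π E) crossesE
      where
      T : Vec Bool n
      T = Vec.tabulate (lookup T′ ∘ π)
      T≗T′∘π : ∀ i → lookup T i ≡ lookup T′ (π i)
      T≗T′∘π = Vec.lookup∘tabulate _
      T⊆S : T ⊆ S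
      T⊆S i Tᵢ = trans (S≗S′∘π i) (T′⊆S′ (π i) (trans (sym (T≗T′∘π i)) Tᵢ))
      T≗T′∘π∘σ : ∀ j → lookup T (σ j) ≡ lookup T′ j
      T≗T′∘π∘σ j = trans (T≗T′∘π (σ j)) (cong (lookup T′) (π∘σ j))
      neT : NonEmpty T
      neT = let (j , T′ⱼ) = neT′ in σ j , trans (T≗T′∘π∘σ j) T′ⱼ
      S⊈T : S ⊈ T
      S⊈T = let (j , S′ⱼ , T′ⱼ) = S′⊈T′ in σ j , trans (sym (S′≗S∘σ j)) S′ⱼ , trans (T≗T′∘π∘σ j) T′ⱼ
      xy-unseparated : lookup T x xor lookup T y ≡ false
      xy-unseparated = trans (cong₂ _xor_ (T≗T′∘π x) (trans (T≗T′∘π y) (cong (lookup T′) (sym πx≡πy))))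
                             (xor-same (lookup T′ (π x)))
      crossesE : crossesᵇ T E ≡ true
      crossesE = begin
        crossesᵇ T E                                         ≡⟨ ∨-identityʳ _ ⟨
        crossesᵇ T E ∨ false                                 ≡⟨ cong (crossesᵇ T E ∨_) xy-unseparated ⟨
        crossesᵇ T E ∨ (lookup T x xor lookup T y)           ≡⟨ crossesᵇ-∷ʳ T E x y ⟨
        crossesᵇ T (E ++ [ (x , y) ])                        ≡⟨ cuts T T⊆S neT S⊈T ⟩
        true                                                 ∎
        where open ≡-Reasoning

  connectedᵇ-contract : connectedᵇ S (E ++ [ (x , y) ]) ≡ connectedᵇ S′ (map (mapEdge π) E)
  connectedᵇ-contract = bool-ext connectedᵇ-contract⁺ connectedᵇ-contract⁻

-- Gluing at a vertex

connectedAtᵇ : ∀ {n} → Fin n → Vec Bool n → List (Fin n × Fin n) → Bool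
connectedAtᵇ v S E = lookup S v ∧ edgesInᵇ S E ∧ connectedᵇ S E

f-∑ : (G : Graph) (v : Fin (order G)) →
      f G v ≡ ∑[ S ∈ allSubsets (order G) ] ∑[ E ∈ sublists (edges G) ] ⟦ connectedAtᵇ v S E ⟧
f-∑ G v = begin
  f G v
    ≡⟨ countᵇ≡∑ (λ (T , E) → connectedAtᵇ v T E) (concatMap withEdgeSets (allSubsets (order G))) ⟩
  ∑ (concatMap withEdgeSets (allSubsets (order G))) (λ (T , E) → ⟦ connectedAtᵇ v T E ⟧)
    ≡⟨ ∑-concatMap withEdgeSets (allSubsets (order G)) _ ⟩
  ∑[ S ∈ allSubsets (order G) ] ∑ (withEdgeSets S) (λ (T , E) → ⟦ connectedAtᵇ v T E ⟧)
    ≡⟨ ∑-cong (λ S → ∑-map (S ,_) (sublists (edges G)) _) (allSubsets (order G)) ⟩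
  ∑[ S ∈ allSubsets (order G) ] ∑[ E ∈ sublists (edges G) ] ⟦ connectedAtᵇ v S E ⟧ ∎
  where
  open ≡-Reasoning
  withEdgeSets : Vec Bool (order G) → List (Vec Bool (order G) × List (Fin (order G) × Fin (order G)))
  withEdgeSets S = map (S ,_) (sublists (edges G))

∑-allSubsets-Empty : ∀ k → ∑[ Y ∈ allSubsets k ] ⟦ not (nonemptyᵇ Y) ⟧ ≡ 1
∑-allSubsets-Empty zero    = refl
∑-allSubsets-Empty (suc k) = trans (∑-allSubsets-suc k _)
  (trans (∑-cong (λ Y → cong (λ b → ⟦ not b ⟧) (nonemptyᵇ-∷ false Y)) (allSubsets k)) (∑-allSubsets-Empty k))

-- A graph K on Fin (suc k) is attached to H by identifying its vertex 0 with w. A vertex set of the glued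
-- graph is X ++ᵛ Y with X ⊆ V(H) and Y ⊆ V(K) ∖ {0}, and kView X Y is its trace on K.
module Gluing {a k : ℕ} (w : Fin a) where

  gluedEdges : List (Fin a × Fin a) → List (Fin (suc k) × Fin (suc k)) → List (Fin (a + k) × Fin (a + k))
  gluedEdges EH EK = map (mapEdge (_↑ˡ k)) EH ++ map (mapEdge (embK w zero)) EK

  kView : Vec Bool a → Vec Bool k → Vec Bool (suc k)
  kView X Y = lookup X w ∷ Y

  lookup-kView : (X : Vec Bool a) (Y : Vec Bool k) (j : Fin (suc k)) →
                 lookup (kView X Y) j ≡ lookup (X ++ᵛ Y) (embK w zero j)
  lookup-kView X Y zero    = sym (Vec.lookup-++ˡ X Y w)
  lookup-kView X Y (suc j) = sym (Vec.lookup-++ʳ X Y j)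

  module _ (X : Vec Bool a) (Y : Vec Bool k) (EH : List (Fin a × Fin a)) (EK : List (Fin (suc k) × Fin (suc k))) where

    crossesᵇ-glue : crossesᵇ (X ++ᵛ Y) (gluedEdges EH EK) ≡ crossesᵇ X EH ∨ crossesᵇ (kView X Y) EK
    crossesᵇ-glue = trans (any-++ _ (map (mapEdge (_↑ˡ k)) EH) _)
      (cong₂ _∨_ (crossesᵇ-map (_↑ˡ k) (X ++ᵛ Y) X (λ i → sym (Vec.lookup-++ˡ X Y i)) EH)
                 (crossesᵇ-map (embK w zero) (X ++ᵛ Y) (kView X Y) (lookup-kView X Y) EK))

    edgesInᵇ-glue : edgesInᵇ (X ++ᵛ Y) (gluedEdges EH EK) ≡ edgesInᵇ X EH ∧ edgesInᵇ (kView X Y) EK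
    edgesInᵇ-glue = trans (all-++ _ (map (mapEdge (_↑ˡ k)) EH) _)
      (cong₂ _∧_ (edgesInᵇ-map (_↑ˡ k) (X ++ᵛ Y) X (λ i → sym (Vec.lookup-++ˡ X Y i)) EH)
                 (edgesInᵇ-map (embK w zero) (X ++ᵛ Y) (kView X Y) (lookup-kView X Y) EK))

  module _ (EH : List (Fin a × Fin a)) (EK : List (Fin (suc k) × Fin (suc k))) where

    private
      E : List (Fin (a + k) × Fin (a + k))
      E = gluedEdges EH EK

      crossesʰ : ∀ TX TY → crossesᵇ TX EH ≡ true → crossesᵇ (TX ++ᵛ TY) E ≡ true
      crossesʰ TX TY c = trans (crossesᵇ-glue TX TY EH EK) (cong (_∨ crossesᵇ (kView TX TY) EK) c)

      crossesᵏ : ∀ TX TY → crossesᵇ (kView TX TY) EK ≡ true → crossesᵇ (TX ++ᵛ TY) E ≡ true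
      crossesᵏ TX TY c = trans (crossesᵇ-glue TX TY EH EK) (trans (cong (crossesᵇ TX EH ∨_) c) (∨-zeroʳ _))

      crossesʰ⁻ : ∀ TX TY → crossesᵇ (TX ++ᵛ TY) E ≡ true → crossesᵇ (kView TX TY) EK ≡ false →
                  crossesᵇ TX EH ≡ true
      crossesʰ⁻ TX TY c = ∨-resolveˡ (trans (sym (crossesᵇ-glue TX TY EH EK)) c)

      crossesᵏ⁻ : ∀ TX TY → crossesᵇ (TX ++ᵛ TY) E ≡ true → crossesᵇ TX EH ≡ false →
                  crossesᵇ (kView TX TY) EK ≡ true
      crossesᵏ⁻ TX TY c = ∨-resolveʳ (trans (sym (crossesᵇ-glue TX TY EH EK)) c)

    module _ (v : Fin a) (X : Vec Bool a) (Y : Vec Bool k) (Xᵥ : lookup X v ≡ true) where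

      private
        S : Vec Bool (a + k)
        S = X ++ᵛ Y

      module _ (inside : edgesInᵇ S E ≡ true) (conn : connectedᵇ S E ≡ true) where

        private
          cuts : CutsCrossed S E
          cuts = proj₂ (connectedᵇ⁻ S E conn)

          insideʰ : edgesInᵇ X EH ≡ true
          insideʰ = proj₁ (∧-true (trans (sym (edgesInᵇ-glue X Y EH EK)) inside))

          insideᵏ : edgesInᵇ (kView X Y) EK ≡ true
          insideᵏ = proj₂ (∧-true {edgesInᵇ X EH} (trans (sym (edgesInᵇ-glue X Y EH EK)) inside))

        hPart-connected : connectedᵇ X EH ≡ true
        hPart-connected = connectedᵇ⁺ X EH (v , Xᵥ) cutsʰ
          where
          cutsʰ : CutsCrossed X EH
          cutsʰ TX TX⊆X neTX X⊈TX with lookup TX w in TXw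
          ... | true  = crossesʰ⁻ TX Y
            (cuts (TX ++ᵛ Y) (⊆-++⁺ TX X Y Y TX⊆X (λ _ → id)) (NonEmpty-++ˡ TX Y neTX) (⊈-++ˡ TX X Y Y X⊈TX))
            (trans (cong (λ b → crossesᵇ (b ∷ Y) EK) (trans TXw (sym (TX⊆X w TXw))))
                   (crossesᵇ-inside (kView X Y) EK insideᵏ))
          ... | false = crossesʰ⁻ TX ∅
            (cuts (TX ++ᵛ ∅) (⊆-++⁺ TX X ∅ Y TX⊆X (∅⊆ Y)) (NonEmpty-++ˡ TX ∅ neTX) (⊈-++ˡ TX X ∅ Y X⊈TX))
            (crossesᵇ-Empty (kView TX ∅) kEmpty EK)
            where
            kEmpty : Empty (kView TX ∅)
            kEmpty zero    = TXw
            kEmpty (suc j) = ∅-Empty j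

        kPart-connected : lookup X w ≡ true → connectedᵇ (true ∷ Y) EK ≡ true
        kPart-connected Xw = connectedᵇ⁺ (true ∷ Y) EK (zero , refl) cutsᵏ
          where
          cutsᵏ : CutsCrossed (true ∷ Y) EK
          cutsᵏ (true ∷ TY) TK⊆K _ (suc j , Yⱼ , TYⱼ) = subst (λ b → crossesᵇ (b ∷ TY) EK ≡ true) Xw
            (crossesᵏ⁻ X TY
              (cuts (X ++ᵛ TY) (⊆-++⁺ X X TY Y (λ _ → id) (TK⊆K ∘ suc)) (NonEmpty-++ˡ X TY (v , Xᵥ))
                    (⊈-++ʳ X X TY Y (j , Yⱼ , TYⱼ)))
              (crossesᵇ-inside X EH insideʰ))
          cutsᵏ (false ∷ TY) TK⊆K (suc j , TYⱼ) _ = subst (λ b → crossesᵇ (b ∷ TY) EK ≡ true) (∅-Empty w)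
            (crossesᵏ⁻ ∅ TY
              (cuts (∅ ++ᵛ TY) (⊆-++⁺ ∅ X TY Y (∅⊆ X) (TK⊆K ∘ suc)) (NonEmpty-++ʳ ∅ TY (j , TYⱼ))
                    (⊈-++ˡ ∅ X TY Y (v , Xᵥ , ∅-Empty v)))
              (crossesᵇ-Empty ∅ ∅-Empty EH))

        kPart-Empty : lookup X w ≡ false → Empty Y
        kPart-Empty Xw j with lookup Y j in Yⱼ
        ... | false = refl
        ... | true  = contradiction (trans (sym crossed) uncrossed) λ ()
          where
          crossed : crossesᵇ (∅ ++ᵛ Y) E ≡ true
          crossed = cuts (∅ ++ᵛ Y) (⊆-++⁺ ∅ X Y Y (∅⊆ X) (λ _ → id)) (NonEmpty-++ʳ ∅ Y (j , Yⱼ))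
                         (⊈-++ˡ ∅ X Y Y (v , Xᵥ , ∅-Empty v))
          uncrossed : crossesᵇ (∅ ++ᵛ Y) E ≡ false
          uncrossed = trans (crossesᵇ-glue ∅ Y EH EK) (cong₂ _∨_ (crossesᵇ-Empty ∅ ∅-Empty EH)
            (trans (cong (λ b → crossesᵇ (b ∷ Y) EK) (trans (∅-Empty w) (sym Xw)))
                   (crossesᵇ-inside (kView X Y) EK insideᵏ)))

      glue-connected : lookup X w ≡ true → connectedᵇ X EH ≡ true → connectedᵇ (true ∷ Y) EK ≡ true →
                       connectedᵇ S E ≡ true
      glue-connected Xw connʰ connᵏ = connectedᵇ⁺ S E (NonEmpty-++ˡ X Y (v , Xᵥ)) cuts
        where
        cutsʰ : CutsCrossed X EH
        cutsʰ = proj₂ (connectedᵇ⁻ X EH connʰ)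
        cutsᵏ : CutsCrossed (true ∷ Y) EK
        cutsᵏ = proj₂ (connectedᵇ⁻ (true ∷ Y) EK connᵏ)
        kView⊆ : ∀ TX {TY} → TY ⊆ Y → kView TX TY ⊆ (true ∷ Y)
        kView⊆ TX TY⊆Y zero    _ = refl
        kView⊆ TX TY⊆Y (suc j)   = TY⊆Y j
        cuts : CutsCrossed S E
        cuts T T⊆S neT S⊈T with Vec.splitAt a T
        ... | TX , TY , refl with ⊆-++⁻ TX X TY Y T⊆S
        ... | TX⊆X , TY⊆Y with nonemptyᵇ TX in neᵇ | properᵇ TX X in ⊈ᵇ
        ... | true  | true  = crossesʰ TX TY (cutsʰ TX TX⊆X (nonemptyᵇ⁻ TX neᵇ) (properᵇ⁻ TX X ⊈ᵇ))
        ... | false | _     = crossesᵏ TX TY (cutsᵏ (kView TX TY) (kView⊆ TX TY⊆Y) neᵏ (zero , refl , emptyX w))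
          where
          emptyX : Empty TX
          emptyX = nonemptyᵇ-false TX neᵇ
          neᵏ : NonEmpty (kView TX TY)
          neᵏ with NonEmpty-++⁻ TX TY neT
          ... | inj₁ (j , TXⱼ) = contradiction (trans (sym TXⱼ) (emptyX j)) λ ()
          ... | inj₂ (j , TYⱼ) = suc j , TYⱼ
        ... | true  | false = crossesᵏ TX TY (cutsᵏ (kView TX TY) (kView⊆ TX TY⊆Y) (zero , X⊆TX w Xw) ⊈ᵏ)
          where
          X⊆TX : X ⊆ TX
          X⊆TX = properᵇ-false TX X ⊈ᵇ
          ⊈ᵏ : (true ∷ Y) ⊈ kView TX TY
          ⊈ᵏ with ⊈-++⁻ TX X TY Y S⊈T
          ... | inj₁ (j , Xⱼ , TXⱼ) = contradiction (trans (sym (X⊆TX j Xⱼ)) TXⱼ) λ ()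
          ... | inj₂ (j , Yⱼ , TYⱼ) = suc j , Yⱼ , TYⱼ

      glue-connected-∅ : Empty Y → connectedᵇ X EH ≡ true → connectedᵇ S E ≡ true
      glue-connected-∅ emptyY connʰ = connectedᵇ⁺ S E (NonEmpty-++ˡ X Y (v , Xᵥ)) cuts
        where
        cutsʰ : CutsCrossed X EH
        cutsʰ = proj₂ (connectedᵇ⁻ X EH connʰ)
        cuts : CutsCrossed S E
        cuts T T⊆S neT S⊈T with Vec.splitAt a T
        ... | TX , TY , refl with ⊆-++⁻ TX X TY Y T⊆S
        ... | TX⊆X , TY⊆Y = crossesʰ TX TY (cutsʰ TX TX⊆X neTX X⊈TX)
          where
          neTX : NonEmpty TX
          neTX with NonEmpty-++⁻ TX TY neT
          ... | inj₁ ne = ne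
          ... | inj₂ (j , TYⱼ) = contradiction (trans (sym (TY⊆Y j TYⱼ)) (emptyY j)) λ ()
          X⊈TX : X ⊈ TX
          X⊈TX with ⊈-++⁻ TX X TY Y S⊈T
          ... | inj₁ X⊈TX = X⊈TX
          ... | inj₂ (j , Yⱼ , _) = contradiction (trans (sym Yⱼ) (emptyY j)) λ ()

  kPartᵇ : Bool → Vec Bool k → List (Fin (suc k) × Fin (suc k)) → Bool
  kPartᵇ true  Y EK = connectedAtᵇ zero (true ∷ Y) EK
  kPartᵇ false Y EK = not (nonemptyᵇ Y) ∧ null EK

  module _ (v : Fin a) (X : Vec Bool a) (Y : Vec Bool k)
           (EH : List (Fin a × Fin a)) (EK : List (Fin (suc k) × Fin (suc k))) where

    private
      S : Vec Bool (a + k)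
      S = X ++ᵛ Y
      E : List (Fin (a + k) × Fin (a + k))
      E = gluedEdges EH EK

    connectedAtᵇ-glue⁻ : connectedAtᵇ (v ↑ˡ k) S E ≡ true → connectedAtᵇ v X EH ∧ kPartᵇ (lookup X w) Y EK ≡ true
    connectedAtᵇ-glue⁻ e with ∧-true e
    ... | Sᵥ , e′ with ∧-true e′
    ... | inside , conn = cong₂ _∧_ (cong₂ _∧_ Xᵥ (cong₂ _∧_ insideʰ (hPart-connected EH EK v X Y Xᵥ inside conn)))
                                    (kPart (lookup X w) refl)
      where
      Xᵥ : lookup X v ≡ true
      Xᵥ = trans (sym (Vec.lookup-++ˡ X Y v)) Sᵥ
      insideʰ : edgesInᵇ X EH ≡ true
      insideʰ = proj₁ (∧-true (trans (sym (edgesInᵇ-glue X Y EH EK)) inside))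
      insideᵏ : edgesInᵇ (kView X Y) EK ≡ true
      insideᵏ = proj₂ (∧-true {edgesInᵇ X EH} (trans (sym (edgesInᵇ-glue X Y EH EK)) inside))
      kPart : ∀ b → lookup X w ≡ b → kPartᵇ b Y EK ≡ true
      kPart true  Xw = cong₂ _∧_ (subst (λ b → edgesInᵇ (b ∷ Y) EK ≡ true) Xw insideᵏ)
                                 (kPart-connected EH EK v X Y Xᵥ inside conn Xw)
      kPart false Xw = cong₂ _∧_ (cong not (nonemptyᵇ-Empty Y emptyY))
                                 (cong null (edgesInᵇ-Empty (kView X Y) emptyᵏ EK insideᵏ))
        where
        emptyY : Empty Y
        emptyY = kPart-Empty EH EK v X Y Xᵥ inside conn Xw
        emptyᵏ : Empty (kView X Y)
        emptyᵏ zero    = Xw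
        emptyᵏ (suc j) = emptyY j

    connectedAtᵇ-glue⁺ : connectedAtᵇ v X EH ∧ kPartᵇ (lookup X w) Y EK ≡ true → connectedAtᵇ (v ↑ˡ k) S E ≡ true
    connectedAtᵇ-glue⁺ e with ∧-true e
    ... | atʰ , kPart with ∧-true atʰ
    ... | Xᵥ , e′ with ∧-true e′
    ... | insideʰ , connʰ = cong₂ _∧_ (trans (Vec.lookup-++ˡ X Y v) Xᵥ) (glued (lookup X w) refl kPart)
      where
      glued : ∀ b → lookup X w ≡ b → kPartᵇ b Y EK ≡ true → edgesInᵇ S E ∧ connectedᵇ S E ≡ true
      glued true Xw kPart with ∧-true kPart
      ... | insideᵏ , connᵏ = cong₂ _∧_
        (trans (edgesInᵇ-glue X Y EH EK)
               (cong₂ _∧_ insideʰ (subst (λ b → edgesInᵇ (b ∷ Y) EK ≡ true) (sym Xw) insideᵏ)))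
        (glue-connected EH EK v X Y Xᵥ Xw connʰ connᵏ)
      glued false Xw kPart with ∧-true kPart
      ... | ¬nonemptyY , nullEK = cong₂ _∧_
        (trans (edgesInᵇ-glue X Y EH EK)
               (cong₂ _∧_ insideʰ (subst (λ L → edgesInᵇ (kView X Y) L ≡ true) (sym (null-true nullEK)) refl)))
        (glue-connected-∅ EH EK v X Y Xᵥ (nonemptyᵇ-false Y (not-injective {nonemptyᵇ Y} {false} ¬nonemptyY)) connʰ)

    connectedAtᵇ-glue : connectedAtᵇ (v ↑ˡ k) S E ≡ connectedAtᵇ v X EH ∧ kPartᵇ (lookup X w) Y EK
    connectedAtᵇ-glue = bool-ext connectedAtᵇ-glue⁻ connectedAtᵇ-glue⁺

weightedF : (H : Graph) → Fin (order H) → Fin (order H) → ℕ → ℕ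
weightedF H w v c =
  ∑[ X ∈ allSubsets (order H) ] ∑[ E ∈ sublists (edges H) ] (⟦ connectedAtᵇ v X E ⟧ * (if lookup X w then c else 1))

module _ (H : Graph) (w v : Fin (order H)) (k : ℕ) (EK : List (Fin (suc k) × Fin (suc k))) where

  open Gluing {order H} {k} w

  private
    K : Graph
    K = graph (suc k) EK

  ∑-kPart : ∀ b → ∑[ Y ∈ allSubsets k ] ∑[ E ∈ sublists EK ] ⟦ kPartᵇ b Y E ⟧ ≡ (if b then f K zero else 1)
  ∑-kPart true = sym (begin
    f K zero
      ≡⟨ f-∑ K zero ⟩
    ∑[ S ∈ allSubsets (suc k) ] ∑[ E ∈ sublists EK ] ⟦ connectedAtᵇ zero S E ⟧
      ≡⟨ ∑-allSubsets-suc k _ ⟩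
    ∑[ Y ∈ allSubsets k ] (∑[ E ∈ sublists EK ] ⟦ connectedAtᵇ zero (true ∷ Y) E ⟧ + ∑[ E ∈ sublists EK ] 0)
      ≡⟨ ∑-cong (λ Y → +-∑-zero (∑[ E ∈ sublists EK ] ⟦ connectedAtᵇ zero (true ∷ Y) E ⟧) (sublists EK)) (allSubsets k) ⟩
    ∑[ Y ∈ allSubsets k ] ∑[ E ∈ sublists EK ] ⟦ kPartᵇ true Y E ⟧ ∎)
    where open ≡-Reasoning
  ∑-kPart false = begin
    ∑[ Y ∈ allSubsets k ] ∑[ E ∈ sublists EK ] ⟦ not (nonemptyᵇ Y) ∧ null E ⟧
      ≡⟨ ∑-cong (λ Y → ∑-cong (λ E → ⟦∧⟧ (not (nonemptyᵇ Y)) (null E)) (sublists EK)) (allSubsets k) ⟩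
    ∑[ Y ∈ allSubsets k ] ∑[ E ∈ sublists EK ] (⟦ not (nonemptyᵇ Y) ⟧ * ⟦ null E ⟧)
      ≡⟨ ∑-cong (λ Y → *-distribˡ-∑ ⟦ not (nonemptyᵇ Y) ⟧ (sublists EK) (λ E → ⟦ null E ⟧)) (allSubsets k) ⟨
    ∑[ Y ∈ allSubsets k ] (⟦ not (nonemptyᵇ Y) ⟧ * ∑[ E ∈ sublists EK ] ⟦ null E ⟧)
      ≡⟨ ∑-cong (λ Y → trans (cong (⟦ not (nonemptyᵇ Y) ⟧ *_) (∑-sublists-null EK)) (*-identityʳ _)) (allSubsets k) ⟩
    ∑[ Y ∈ allSubsets k ] ⟦ not (nonemptyᵇ Y) ⟧
      ≡⟨ ∑-allSubsets-Empty k ⟩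
    1 ∎
    where open ≡-Reasoning

  ∑-sublists-glue : ∀ X Y →
    ∑[ E ∈ sublists (gluedEdges (edges H) EK) ] ⟦ connectedAtᵇ (v ↑ˡ k) (X ++ᵛ Y) E ⟧ ≡
    ∑[ EH ∈ sublists (edges H) ] (⟦ connectedAtᵇ v X EH ⟧ * ∑[ E ∈ sublists EK ] ⟦ kPartᵇ (lookup X w) Y E ⟧)
  ∑-sublists-glue X Y = begin
    ∑[ E ∈ sublists (gluedEdges (edges H) EK) ] ⟦ connectedAtᵇ (v ↑ˡ k) (X ++ᵛ Y) E ⟧
      ≡⟨ ∑-sublists-++ (map (mapEdge (_↑ˡ k)) (edges H)) (map (mapEdge (embK w zero)) EK) _ ⟩
    ∑[ E₁ ∈ sublists (map (mapEdge (_↑ˡ k)) (edges H)) ] ∑[ E₂ ∈ sublists (map (mapEdge (embK w zero)) EK) ]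
      ⟦ connectedAtᵇ (v ↑ˡ k) (X ++ᵛ Y) (E₁ ++ E₂) ⟧
      ≡⟨ ∑-sublists-map (mapEdge (_↑ˡ k)) (edges H) _ ⟩
    ∑[ EH ∈ sublists (edges H) ] ∑[ E₂ ∈ sublists (map (mapEdge (embK w zero)) EK) ]
      ⟦ connectedAtᵇ (v ↑ˡ k) (X ++ᵛ Y) (map (mapEdge (_↑ˡ k)) EH ++ E₂) ⟧
      ≡⟨ ∑-cong (λ EH → ∑-sublists-map (mapEdge (embK w zero)) EK _) (sublists (edges H)) ⟩
    ∑[ EH ∈ sublists (edges H) ] ∑[ E ∈ sublists EK ] ⟦ connectedAtᵇ (v ↑ˡ k) (X ++ᵛ Y) (gluedEdges EH E) ⟧
      ≡⟨ ∑-cong (λ EH → ∑-cong (λ E → cong ⟦_⟧ (connectedAtᵇ-glue v X Y EH E)) (sublists EK)) (sublists (edges H)) ⟩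
    ∑[ EH ∈ sublists (edges H) ] ∑[ E ∈ sublists EK ] ⟦ connectedAtᵇ v X EH ∧ kPartᵇ (lookup X w) Y E ⟧
      ≡⟨ ∑-cong (λ EH → ∑-cong (λ E → ⟦∧⟧ (connectedAtᵇ v X EH) _) (sublists EK)) (sublists (edges H)) ⟩
    ∑[ EH ∈ sublists (edges H) ] ∑[ E ∈ sublists EK ] (⟦ connectedAtᵇ v X EH ⟧ * ⟦ kPartᵇ (lookup X w) Y E ⟧)
      ≡⟨ ∑-cong (λ EH → *-distribˡ-∑ ⟦ connectedAtᵇ v X EH ⟧ (sublists EK) _) (sublists (edges H)) ⟨
    ∑[ EH ∈ sublists (edges H) ] (⟦ connectedAtᵇ v X EH ⟧ * ∑[ E ∈ sublists EK ] ⟦ kPartᵇ (lookup X w) Y E ⟧) ∎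
    where open ≡-Reasoning

  f-glue : f (glue H w K zero) (embH H K v) ≡ weightedF H w v (f K zero)
  f-glue = begin
    f (glue H w K zero) (embH H K v)
      ≡⟨ f-∑ (glue H w K zero) (embH H K v) ⟩
    ∑[ S ∈ allSubsets (order H + k) ] ∑[ E ∈ sublists (gluedEdges (edges H) EK) ] ⟦ connectedAtᵇ (v ↑ˡ k) S E ⟧
      ≡⟨ ∑-allSubsets-++ (order H) k _ ⟩
    ∑[ X ∈ allSubsets (order H) ] ∑[ Y ∈ allSubsets k ] ∑[ E ∈ sublists (gluedEdges (edges H) EK) ]
      ⟦ connectedAtᵇ (v ↑ˡ k) (X ++ᵛ Y) E ⟧
      ≡⟨ ∑-cong (λ X → ∑-cong (∑-sublists-glue X) (allSubsets k)) (allSubsets (order H)) ⟩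
    ∑[ X ∈ allSubsets (order H) ] ∑[ Y ∈ allSubsets k ] ∑[ EH ∈ sublists (edges H) ]
      (⟦ connectedAtᵇ v X EH ⟧ * ∑[ E ∈ sublists EK ] ⟦ kPartᵇ (lookup X w) Y E ⟧)
      ≡⟨ ∑-cong (λ X → ∑-comm (allSubsets k) (sublists (edges H)) _) (allSubsets (order H)) ⟩
    ∑[ X ∈ allSubsets (order H) ] ∑[ EH ∈ sublists (edges H) ] ∑[ Y ∈ allSubsets k ]
      (⟦ connectedAtᵇ v X EH ⟧ * ∑[ E ∈ sublists EK ] ⟦ kPartᵇ (lookup X w) Y E ⟧)
      ≡⟨ ∑-cong (λ X → ∑-cong (λ EH → *-distribˡ-∑ ⟦ connectedAtᵇ v X EH ⟧ (allSubsets k) _) (sublists (edges H)))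
                (allSubsets (order H)) ⟨
    ∑[ X ∈ allSubsets (order H) ] ∑[ EH ∈ sublists (edges H) ]
      (⟦ connectedAtᵇ v X EH ⟧ * ∑[ Y ∈ allSubsets k ] ∑[ E ∈ sublists EK ] ⟦ kPartᵇ (lookup X w) Y E ⟧)
      ≡⟨ ∑-cong (λ X → ∑-cong (λ EH → cong (⟦ connectedAtᵇ v X EH ⟧ *_) (∑-kPart (lookup X w))) (sublists (edges H)))
                (allSubsets (order H)) ⟩
    weightedF H w v (f K zero) ∎
    where open ≡-Reasoning

weightedF-mono-< : (H : Graph) → Connected H → (w v : Fin (order H)) →
                   ∀ {c₁ c₂} → c₁ < c₂ → weightedF H w v c₁ < weightedF H w v c₂
weightedF-mono-< H conn w v {c₁} {c₂} c₁<c₂ =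
  ∑-mono-< (λ X → ∑-mono-≤ (termwise X) (sublists (edges H))) (full∈allSubsets (order H))
           (∑-mono-< (termwise full) (xs∈sublists (edges H)) wholeGraph)
  where
  full : Vec Bool (order H)
  full = Vec.replicate (order H) true
  weight-≤ : ∀ b → (if b then c₁ else 1) ≤ (if b then c₂ else 1)
  weight-≤ true  = <⇒≤ c₁<c₂
  weight-≤ false = ≤-refl
  termwise : ∀ X E → ⟦ connectedAtᵇ v X E ⟧ * (if lookup X w then c₁ else 1)
                   ≤ ⟦ connectedAtᵇ v X E ⟧ * (if lookup X w then c₂ else 1)
  termwise X E = *-monoʳ-≤ ⟦ connectedAtᵇ v X E ⟧ (weight-≤ (lookup X w))
  H-connectedAt : connectedAtᵇ v full (edges H) ≡ true
  H-connectedAt = cong₂ _∧_ (Vec.lookup-replicate v true) (cong₂ _∧_ (edgesInᵇ-full (edges H)) conn)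
  wholeGraph : ⟦ connectedAtᵇ v full (edges H) ⟧ * (if lookup full w then c₁ else 1)
             < ⟦ connectedAtᵇ v full (edges H) ⟧ * (if lookup full w then c₂ else 1)
  wholeGraph rewrite H-connectedAt | Vec.lookup-replicate w true = +-mono-<-≤ c₁<c₂ z≤n

weightedF-self : (G : Graph) (u : Fin (order G)) (c : ℕ) → weightedF G u u c ≡ c * f G u
weightedF-self G u c = begin
  weightedF G u u c
    ≡⟨ ∑-cong (λ X → ∑-cong (termwise X) (sublists (edges G))) (allSubsets (order G)) ⟩
  ∑[ X ∈ allSubsets (order G) ] ∑[ E ∈ sublists (edges G) ] (c * ⟦ connectedAtᵇ u X E ⟧)
    ≡⟨ ∑-cong (λ X → *-distribˡ-∑ c (sublists (edges G)) _) (allSubsets (order G)) ⟨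
  ∑[ X ∈ allSubsets (order G) ] (c * ∑[ E ∈ sublists (edges G) ] ⟦ connectedAtᵇ u X E ⟧)
    ≡⟨ *-distribˡ-∑ c (allSubsets (order G)) _ ⟨
  c * ∑[ X ∈ allSubsets (order G) ] ∑[ E ∈ sublists (edges G) ] ⟦ connectedAtᵇ u X E ⟧
    ≡⟨ cong (c *_) (f-∑ G u) ⟨
  c * f G u ∎
  where
  open ≡-Reasoning
  termwise : ∀ X E → ⟦ connectedAtᵇ u X E ⟧ * (if lookup X u then c else 1) ≡ c * ⟦ connectedAtᵇ u X E ⟧
  termwise X E with lookup X u
  ... | true  = *-comm _ c
  ... | false = sym (*-zeroʳ c)

module _ (H : Graph) (w : Fin (order H)) {k k′ : ℕ}
         {EK : List (Fin (suc k) × Fin (suc k))} {EK′ : List (Fin (suc k′) × Fin (suc k′))} where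

  private
    K K′ : Graph
    K  = graph (suc k) EK
    K′ = graph (suc k′) EK′

  f-glue-mono-< : Connected H → (v : Fin (order H)) → f K zero < f K′ zero →
                  f (glue H w K zero) (embH H K v) < f (glue H w K′ zero) (embH H K′ v)
  f-glue-mono-< conn v fK<fK′ = begin-strict
    f (glue H w K zero) (embH H K v)    ≡⟨ f-glue H w v k EK ⟩
    weightedF H w v (f K zero)          <⟨ weightedF-mono-< H conn w v fK<fK′ ⟩
    weightedF H w v (f K′ zero)         ≡⟨ f-glue H w v k′ EK′ ⟨
    f (glue H w K′ zero) (embH H K′ v)  ∎
    where open ≤-Reasoning

f-glue-cut : (G : Graph) (u : Fin (order G)) (k : ℕ) (EK : List (Fin (suc k) × Fin (suc k))) →
             f (glue G u (graph (suc k) EK) zero) (embH G (graph (suc k) EK) u) ≡ f (graph (suc k) EK) zero * f G u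
f-glue-cut G u k EK = trans (f-glue G u u k EK) (weightedF-self G u _)

-- Paths and cycles

pathEdge : ∀ {m} → Fin m → Fin (suc m) × Fin (suc m)
pathEdge i = inject₁ i , suc i

pathEdges : (n : ℕ) → List (Fin n × Fin n)
pathEdges zero    = []
pathEdges (suc k) = map pathEdge (allFin k)

P : ℕ → Graph
P n = graph n (pathEdges n)

-- weightedF K2 1 0 c evaluates to c + 0 + 0 + 1.
weightedF-K2 : ∀ c → weightedF K2 (suc zero) zero c ≡ suc c
weightedF-K2 c = trans (+-comm (c + 0 + 0) 1) (cong suc (trans (+-identityʳ (c + 0)) (+-identityʳ c)))

pathEdges-glue : ∀ k → edges (glue K2 (suc zero) (P (suc k)) zero) ≡ pathEdges (suc (suc k))
pathEdges-glue k = cong ((zero , suc zero) ∷_) (begin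
  map (mapEdge (embK (suc zero) zero)) (map pathEdge (allFin k))  ≡⟨ List.map-∘ (allFin k) ⟨
  map (mapEdge (embK (suc zero) zero) ∘ pathEdge) (allFin k)      ≡⟨ List.map-tabulate id _ ⟩
  tabulate (mapEdge (embK (suc zero) zero) ∘ pathEdge)            ≡⟨ List.tabulate-cong shifted ⟩
  tabulate (pathEdge ∘ suc)                                       ≡⟨ List.map-tabulate suc pathEdge ⟨
  map pathEdge (tabulate suc)                                     ∎)
  where
  open ≡-Reasoning
  shifted : ∀ (i : Fin k) → mapEdge (embK (suc zero) zero) (pathEdge i) ≡ pathEdge (suc i)
  shifted zero    = refl
  shifted (suc i) = refl

f-path : ∀ k → f (P (suc k)) zero ≡ suc k
f-path zero    = refl
f-path (suc k) = begin
  f (P (suc (suc k))) zero                           ≡⟨ cong (λ E → f (graph (suc (suc k)) E) zero) (pathEdges-glue k) ⟨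
  f (glue K2 (suc zero) (P (suc k)) zero) zero       ≡⟨ f-glue K2 (suc zero) zero k (pathEdges (suc k)) ⟩
  weightedF K2 (suc zero) zero (f (P (suc k)) zero)  ≡⟨ weightedF-K2 _ ⟩
  suc (f (P (suc k)) zero)                           ≡⟨ cong suc (f-path k) ⟩
  suc (suc k)                                        ∎
  where open ≡-Reasoning

wrapLast : ∀ {n} → Fin (suc (suc n)) → Fin (suc n)
wrapLast i with view i
... | ‵fromℕ      = zero
... | ‵inject₁ i′ = i′

wrapLast-inject₁ : ∀ {n} (i : Fin (suc n)) → wrapLast (inject₁ i) ≡ i
wrapLast-inject₁ i rewrite view-inject₁ i = refl

wrapLast-fromℕ : ∀ n → wrapLast (fromℕ (suc n)) ≡ zero
wrapLast-fromℕ n rewrite view-fromℕ (suc n) = refl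

pathEdges-wrap : ∀ j → map (mapEdge wrapLast) (pathEdges (suc (suc j))) ≡ cycleEdges (suc j)
pathEdges-wrap j = begin
  map (mapEdge wrapLast) (map pathEdge (allFin (suc j)))
    ≡⟨ List.map-∘ (allFin (suc j)) ⟨
  map (mapEdge wrapLast ∘ pathEdge) (allFin (suc j))
    ≡⟨ List.map-tabulate id _ ⟩
  tabulate (mapEdge wrapLast ∘ pathEdge)
    ≡⟨ tabulate-∷ʳ j (mapEdge wrapLast ∘ pathEdge) ⟩
  tabulate (mapEdge wrapLast ∘ pathEdge ∘ inject₁) ++ [ mapEdge wrapLast (pathEdge (fromℕ j)) ]
    ≡⟨ cong₂ (λ es e → es ++ [ e ]) (List.tabulate-cong unwrapped) closing ⟩
  tabulate pathEdge ++ [ (fromℕ j , zero) ]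
    ≡⟨ cong (_++ [ (fromℕ j , zero) ]) (List.map-tabulate id pathEdge) ⟨
  cycleEdges (suc j) ∎
  where
  open ≡-Reasoning
  unwrapped : ∀ i → mapEdge wrapLast (pathEdge (inject₁ i)) ≡ pathEdge i
  unwrapped i = cong₂ _,_ (wrapLast-inject₁ (inject₁ i)) (wrapLast-inject₁ (suc i))
  closing : mapEdge wrapLast (pathEdge (fromℕ j)) ≡ (fromℕ j , zero)
  closing = cong₂ _,_ (wrapLast-inject₁ (fromℕ j)) (wrapLast-fromℕ j)

module _ (j : ℕ) where

  private
    k n : ℕ
    k = suc j
    n = suc k
    closing : Fin n × Fin n
    closing = fromℕ k , zero

  connectedAtᵇ-closing-∉ : ∀ (S : Vec Bool k) E → connectedAtᵇ zero (S ∷ʳ false) (E ++ [ closing ]) ≡ false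
  connectedAtᵇ-closing-∉ S E =
    trans (cong (λ b → lookup (S ∷ʳ false) zero ∧ (b ∧ connectedᵇ (S ∷ʳ false) (E ++ [ closing ]))) edgesIn-false)
          (∧-zeroʳ _)
    where
    edgesIn-false : edgesInᵇ (S ∷ʳ false) (E ++ [ closing ]) ≡ false
    edgesIn-false = trans (edgesInᵇ-∷ʳ (S ∷ʳ false) E (fromℕ k) zero)
      (trans (cong (λ b → edgesInᵇ (S ∷ʳ false) E ∧ (b ∧ lookup (S ∷ʳ false) zero)) (lookup-∷ʳ-fromℕ S false))
             (∧-zeroʳ _))

  connectedAtᵇ-closing-contract : ∀ (S : Vec Bool k) E →
    connectedAtᵇ zero (S ∷ʳ true) (E ++ [ closing ]) ≡ connectedAtᵇ zero S (map (mapEdge wrapLast) E)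
  connectedAtᵇ-closing-contract (false ∷ S) E = refl
  connectedAtᵇ-closing-contract (true  ∷ S) E = cong₂ _∧_ edgesIn-eq connected-eq
    where
    S′ : Vec Bool k
    S′ = true ∷ S
    T : Vec Bool n
    T = S′ ∷ʳ true
    T≗S′∘wrapLast : ∀ i → lookup T i ≡ lookup S′ (wrapLast i)
    T≗S′∘wrapLast i with view i
    ... | ‵fromℕ      = lookup-∷ʳ-fromℕ S′ true
    ... | ‵inject₁ i′ = lookup-∷ʳ-inject₁ S′ true i′
    fibres : ∀ U → lookup U (fromℕ k) ≡ lookup U zero → ∀ i → lookup U (inject₁ (wrapLast i)) ≡ lookup U i
    fibres U e i with view i
    ... | ‵fromℕ      = sym e
    ... | ‵inject₁ i′ = refl
    edgesIn-eq : edgesInᵇ T (E ++ [ closing ]) ≡ edgesInᵇ S′ (map (mapEdge wrapLast) E)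
    edgesIn-eq = trans (edgesInᵇ-∷ʳ T E (fromℕ k) zero)
      (trans (cong (λ b → edgesInᵇ T E ∧ (b ∧ true)) (lookup-∷ʳ-fromℕ S′ true))
      (trans (∧-identityʳ _) (sym (edgesInᵇ-map wrapLast S′ T T≗S′∘wrapLast E))))
    connected-eq : connectedᵇ T (E ++ [ closing ]) ≡ connectedᵇ S′ (map (mapEdge wrapLast) E)
    connected-eq = Contraction.connectedᵇ-contract wrapLast inject₁ wrapLast-inject₁ (fromℕ k) zero
      (trans (wrapLast-fromℕ j) (sym (wrapLast-inject₁ zero))) fibres S′ T T≗S′∘wrapLast E

  ∑-closing : ∑[ S ∈ allSubsets n ] ∑[ E ∈ sublists (pathEdges n) ] ⟦ connectedAtᵇ zero S (E ++ [ closing ]) ⟧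
            ≡ f (C k) zero
  ∑-closing = begin
    ∑[ S ∈ allSubsets n ] ∑[ E ∈ sublists (pathEdges n) ] ⟦ connectedAtᵇ zero S (E ++ [ closing ]) ⟧
      ≡⟨ ∑-allSubsets-∷ʳ k _ ⟩
    ∑[ S ∈ allSubsets k ] (∑[ E ∈ sublists (pathEdges n) ] ⟦ connectedAtᵇ zero (S ∷ʳ true) (E ++ [ closing ]) ⟧
                         + ∑[ E ∈ sublists (pathEdges n) ] ⟦ connectedAtᵇ zero (S ∷ʳ false) (E ++ [ closing ]) ⟧)
      ≡⟨ ∑-cong (λ S → cong₂ _+_ (∑-cong (λ E → cong ⟦_⟧ (connectedAtᵇ-closing-contract S E)) (sublists (pathEdges n)))
                                 (∑-cong (λ E → cong ⟦_⟧ (connectedAtᵇ-closing-∉ S E)) (sublists (pathEdges n))))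
                (allSubsets k) ⟩
    ∑[ S ∈ allSubsets k ] (∑[ E ∈ sublists (pathEdges n) ] ⟦ connectedAtᵇ zero S (map (mapEdge wrapLast) E) ⟧
                         + ∑[ E ∈ sublists (pathEdges n) ] 0)
      ≡⟨ ∑-cong (λ S → +-∑-zero (∑[ E ∈ sublists (pathEdges n) ] ⟦ connectedAtᵇ zero S (map (mapEdge wrapLast) E) ⟧)
                                 (sublists (pathEdges n))) (allSubsets k) ⟩
    ∑[ S ∈ allSubsets k ] ∑[ E ∈ sublists (pathEdges n) ] ⟦ connectedAtᵇ zero S (map (mapEdge wrapLast) E) ⟧
      ≡⟨ ∑-cong (λ S → ∑-sublists-map (mapEdge wrapLast) (pathEdges n) _) (allSubsets k) ⟨
    ∑[ S ∈ allSubsets k ] ∑[ E ∈ sublists (map (mapEdge wrapLast) (pathEdges n)) ] ⟦ connectedAtᵇ zero S E ⟧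
      ≡⟨ cong (λ es → ∑[ S ∈ allSubsets k ] ∑[ E ∈ sublists es ] ⟦ connectedAtᵇ zero S E ⟧) (pathEdges-wrap j) ⟩
    ∑[ S ∈ allSubsets k ] ∑[ E ∈ sublists (cycleEdges k) ] ⟦ connectedAtᵇ zero S E ⟧
      ≡⟨ f-∑ (C k) zero ⟨
    f (C k) zero ∎
    where open ≡-Reasoning

  f-cycle-step : f (C n) zero ≡ f (P n) zero + f (C k) zero
  f-cycle-step = begin
    f (C n) zero
      ≡⟨ f-∑ (C n) zero ⟩
    ∑[ S ∈ allSubsets n ] ∑[ E ∈ sublists (pathEdges n ++ [ closing ]) ] ⟦ connectedAtᵇ zero S E ⟧
      ≡⟨ ∑-cong (λ S → ∑-sublists-∷ʳ (pathEdges n) closing _) (allSubsets n) ⟩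
    ∑[ S ∈ allSubsets n ] (∑[ E ∈ sublists (pathEdges n) ] ⟦ connectedAtᵇ zero S (E ++ [ closing ]) ⟧
                         + ∑[ E ∈ sublists (pathEdges n) ] ⟦ connectedAtᵇ zero S E ⟧)
      ≡⟨ ∑-distrib-+ (allSubsets n) _ _ ⟩
    ∑[ S ∈ allSubsets n ] ∑[ E ∈ sublists (pathEdges n) ] ⟦ connectedAtᵇ zero S (E ++ [ closing ]) ⟧
      + ∑[ S ∈ allSubsets n ] ∑[ E ∈ sublists (pathEdges n) ] ⟦ connectedAtᵇ zero S E ⟧
      ≡⟨ cong₂ _+_ ∑-closing (sym (f-∑ (P n) zero)) ⟩
    f (C k) zero + f (P n) zero
      ≡⟨ +-comm (f (C k) zero) (f (P n) zero) ⟩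
    f (P n) zero + f (C k) zero ∎
    where open ≡-Reasoning

tri : ℕ → ℕ
tri zero    = 0
tri (suc n) = suc n + tri n

f-cycle : ∀ j → f (C (suc j)) zero ≡ suc (tri (suc j))
f-cycle zero    = refl
f-cycle (suc j) = begin
  f (C (suc (suc j))) zero                       ≡⟨ f-cycle-step j ⟩
  f (P (suc (suc j))) zero + f (C (suc j)) zero  ≡⟨ cong₂ _+_ (f-path (suc j)) (f-cycle j) ⟩
  suc (suc j) + suc (tri (suc j))                ≡⟨ +-suc (suc (suc j)) (tri (suc j)) ⟩
  suc (tri (suc (suc j)))                        ∎
  where open ≡-Reasoning

f-L : ∀ m (p : 0 < suc m) → f (L (suc m) p) zero ≡ 2 * suc (tri (suc m))
f-L m p = trans (f-glue-cut (C (suc m)) zero 1 (edges K2)) (cong (2 *_) (f-cycle m))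

f-CC : ∀ m₁ m₂ (p : 0 < suc m₁) (q : 0 < suc m₂) →
       f (CC (suc m₁) (suc m₂) p q) zero ≡ suc (tri (suc m₁)) * suc (tri (suc m₂))
f-CC m₁ m₂ p q = begin
  f (CC (suc m₁) (suc m₂) p q) zero
    ≡⟨ f-glue-cut (C (suc m₁)) zero m₂ (cycleEdges (suc m₂)) ⟩
  f (C (suc m₂)) zero * f (C (suc m₁)) zero
    ≡⟨ cong₂ _*_ (f-cycle m₂) (f-cycle m₁) ⟩
  suc (tri (suc m₂)) * suc (tri (suc m₁))
    ≡⟨ *-comm (suc (tri (suc m₂))) _ ⟩
  suc (tri (suc m₁)) * suc (tri (suc m₂)) ∎
  where open ≡-Reasoning

n≤tri : ∀ n → n ≤ tri n
n≤tri zero    = z≤n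
n≤tri (suc n) = m≤m+n (suc n) (tri n)

n<tri : ∀ n → 2 ≤ n → n < tri n
n<tri (suc zero)    (s≤s ())
n<tri (suc (suc n)) _ = m<m+n (suc (suc n)) (s≤s z≤n)

tri-+ : ∀ m n → tri (m + n) ≡ tri m + tri n + m * n
tri-+ zero    n = sym (+-identityʳ (tri n))
tri-+ (suc m) n = trans (cong (suc (m + n) +_) (tri-+ m n)) (regroup m n (tri m) (tri n) (m * n))
  where
  regroup : ∀ m n a b c → suc (m + n) + (a + b + c) ≡ suc m + a + b + (n + c)
  regroup = solve-∀

1+tri-suc<2*[1+tri] : ∀ n → 2 ≤ n → suc (tri (suc n)) < 2 * suc (tri n)
1+tri-suc<2*[1+tri] n 2≤n = begin-strict
  suc (tri (suc n))      ≡⟨ regroup n (tri n) ⟩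
  2 + (n + tri n)        <⟨ +-monoʳ-< 2 (+-monoˡ-< (tri n) (n<tri n 2≤n)) ⟩
  2 + (tri n + tri n)    ≡⟨ double (tri n) ⟩
  2 * suc (tri n)        ∎
  where
  open ≤-Reasoning
  regroup : ∀ n t → suc (suc n + t) ≡ 2 + (n + t)
  regroup = solve-∀
  double : ∀ t → 2 + (t + t) ≡ 2 * suc t
  double = solve-∀

1+tri-+<[1+tri]*[1+tri] : ∀ p q → suc (tri (p + suc q)) < suc (tri (suc p)) * suc (tri (suc q))
1+tri-+<[1+tri]*[1+tri] p q = begin-strict
  suc (tri (p + suc q))
    ≡⟨ cong (suc ∘′ tri) (+-suc p q) ⟩
  suc (tri (suc p + q))
    ≡⟨ cong suc (tri-+ (suc p) q) ⟩
  suc (tri (suc p) + tri q + suc p * q)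
    <⟨ +-monoʳ-< (suc (tri (suc p) + tri q)) (<-≤-trans product< (m≤n+m _ (suc q))) ⟩
  suc (tri (suc p) + tri q + (suc q + tri (suc p) * tri (suc q)))
    ≡⟨ expand (tri (suc p)) q (tri q) ⟩
  suc (tri (suc p)) * suc (tri (suc q)) ∎
  where
  open ≤-Reasoning
  product< : suc p * q < tri (suc p) * tri (suc q)
  product< = <-≤-trans (*-monoʳ-< (suc p) (n<1+n q)) (*-mono-≤ (n≤tri (suc p)) (n≤tri (suc q)))
  expand : ∀ a q t → suc (a + t + (suc q + a * suc (q + t))) ≡ suc a * suc (suc (q + t))
  expand = solve-∀

lemma3p8 : (m₁ m₂ : ℕ) (h₁ : 3 ≤ m₁) (h₂ : 3 ≤ m₂)
           (H : Graph) → Simple H → Connected H → (w : Fin (order H)) →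
           (v : Fin (order H)) →
           (f (glue H w (C (m₁ + m₂ ∸ 1)) (v0 (posN h₁ h₂)))
              (embH H (C (m₁ + m₂ ∸ 1)) v)
            < f (glue H w (L (m₁ + m₂ ∸ 1 ∸ 1) (posL h₁ h₂)) (cutL (m₁ + m₂ ∸ 1 ∸ 1) (posL h₁ h₂)))
                (embH H (L (m₁ + m₂ ∸ 1 ∸ 1) (posL h₁ h₂)) v))
           ×
           (f (glue H w (C (m₁ + m₂ ∸ 1)) (v0 (posN h₁ h₂)))
              (embH H (C (m₁ + m₂ ∸ 1)) v)
            < f (glue H w (CC m₁ m₂ (pos3 h₁) (pos3 h₂)) (cutCC m₁ m₂ (pos3 h₁) (pos3 h₂)))
                (embH H (CC m₁ m₂ (pos3 h₁) (pos3 h₂)) v))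
lemma3p8 m₁@(suc (suc (suc a))) m₂@(suc (suc (suc b))) (s≤s (s≤s (s≤s _))) (s≤s (s≤s (s≤s _))) H _ conn w v =
  f-glue-mono-< H w conn v cycle<L , f-glue-mono-< H w conn v cycle<CC
  where
  open ≤-Reasoning
  n : ℕ
  n = suc (a + m₂)
  cycle<L : f (C (suc n)) zero < f (L n (s≤s z≤n)) zero
  cycle<L = begin-strict
    f (C (suc n)) zero         ≡⟨ f-cycle n ⟩
    suc (tri (suc n))          <⟨ 1+tri-suc<2*[1+tri] n (s≤s (≤-trans (s≤s z≤n) (m≤n+m m₂ a))) ⟩
    2 * suc (tri n)            ≡⟨ f-L (a + m₂) (s≤s z≤n) ⟨
    f (L n (s≤s z≤n)) zero     ∎
  cycle<CC : f (C (suc n)) zero < f (CC m₁ m₂ (s≤s z≤n) (s≤s z≤n)) zero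
  cycle<CC = begin-strict
    f (C (suc n)) zero                        ≡⟨ f-cycle n ⟩
    suc (tri (suc n))                         <⟨ 1+tri-+<[1+tri]*[1+tri] (suc (suc a)) (suc (suc b)) ⟩
    suc (tri m₁) * suc (tri m₂)               ≡⟨ f-CC (suc (suc a)) (suc (suc b)) (s≤s z≤n) (s≤s z≤n) ⟨
    f (CC m₁ m₂ (s≤s z≤n) (s≤s z≤n)) zero     ∎
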